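{- Let $n\in\mathbb{Z}^+$ and let $S=\{s_1,\dots,s_j\}$ be a finite set of distinct positive integers. Let $C$ be the set of tuples $\mathbf{c}=(c_1,\dots,c_j)$ of nonnegative integers with $\sum_{i=1}^j s_ic_i=n$. Then $$|\mathrm{FR}^{\mathrm{T2}}_{n,S}|=n!\sum_{\mathbf{c}\in C}\binom{\sum_{k=1}^j c_k}{c_1,\dots,c_j}\prod_{i=1}^j (s_i!)^{ -c_i}.$$
   Context: A Fubini ranking of length $n$ is a tuple $(b_1,\dots,b_n)\in[n]^n$ that satisfies two conditions. First, some $b_i$ equals $1$. Second, for every value $x$ occurring exactly $k>0$ times, the next larger value occurring in the tuple (if there is one) is $x+k$. For $S\subseteq\mathbb{Z}^+$, $\mathrm{FR}^{\mathrm{T2}}_{n,S}$ is the set of Fubini rankings of length $n$ in which every value that occurs has its number of occurrences in $S$. -}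

module Defs where

open import Data.Nat as ℕ using (ℕ; zero; suc; _+_; _*_; _^_; _≤_; _<_; _≟_; _<?_; _≤?_; _!; NonZero)
open import Data.Nat.Properties using (_!≢0; m*n≢0; m^n≢0)
open import Data.Integer using (+_)
open import Data.Rational as ℚ using (ℚ; _/_)
open import Data.Product using (_×_)
open import Data.List as List using (List; []; _∷_; concatMap; upTo; filter; length)
open import Data.Vec as Vec using (Vec; []; _∷_; count; zipWith)
open import Data.Vec.Relation.Unary.All using (All; all?)
open import Data.Vec.Relation.Unary.Any using (Any; any?)
open import Data.Vec.Membership.Propositional using (_∈_)
open import Data.Vec.Membership.DecPropositional _≟_ using (_∈?_)
open import Relation.Nullary using (Dec)
open import Relation.Nullary.Decidable using (_×-dec_; _→-dec_)
open import Relation.Binary.PropositionalEquality using (_≡_)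

occ : ∀ {n} → ℕ → Vec ℕ n → ℕ
occ x b = count (_≟ x) b

-- "for the value x (occurring k = occ x b times) the next larger value
--  occurring in b, if there is one, is x + k":
--  every occurring value y > x satisfies y ≥ x + k, and if some value
--  larger than x occurs then x + k occurs (so x + k is the minimum of the
--  values larger than x, as k > 0).
NextOK : ∀ {n} → Vec ℕ n → ℕ → Set
NextOK b x =
  All (λ y → x < y → x + occ x b ≤ y) b
  × (Any (x <_) b → Any (_≡ x + occ x b) b)

IsFubiniRanking : ∀ n → Vec ℕ n → Set
IsFubiniRanking n b =
  All (λ x → 1 ≤ x × x ≤ n) b
  × Any (_≡ 1) b
  × All (NextOK b) b

IsFR-T2 : ∀ n {j} → Vec ℕ j → Vec ℕ n → Set
IsFR-T2 n S b = IsFubiniRanking n b × All (λ x → occ x b ∈ S) b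

isFR-T2? : ∀ n {j} (S : Vec ℕ j) (b : Vec ℕ n) → Dec (IsFR-T2 n S b)
isFR-T2? n S b =
  (all? (λ x → (1 ≤? x) ×-dec (x ≤? n)) b
   ×-dec (any? (_≟ 1) b
   ×-dec all? (λ x → all? (λ y → (x <? y) →-dec (x + occ x b ≤? y)) b
                      ×-dec (any? (x <?_) b →-dec any? (_≟ x + occ x b) b)) b))
  ×-dec all? (λ x → occ x b ∈? S) b

tuples : List ℕ → (k : ℕ) → List (Vec ℕ k)
tuples vs zero    = [] ∷ []
tuples vs (suc k) = concatMap (λ x → List.map (x ∷_) (tuples vs k)) vs

range1 : ℕ → List ℕ
range1 m = List.map suc (upTo m)

numFR-T2 : ∀ n {j} → Vec ℕ j → ℕ
numFR-T2 n S = length (filter (isFR-T2? n S) (tuples (range1 n) n))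

-- C = { c ∈ ℕʲ : Σ sᵢ cᵢ = n }.  Since every sᵢ ≥ 1, each such c has
-- cᵢ ≤ n, so C is enumerated by filtering {0,…,n}ʲ.
weight : ∀ {j} → Vec ℕ j → Vec ℕ j → ℕ
weight s c = Vec.sum (zipWith _*_ s c)

Cset : (n : ℕ) → ∀ {j} → Vec ℕ j → List (Vec ℕ j)
Cset n {j} s = filter (λ c → weight s c ≟ n) (tuples (upTo (suc n)) j)

prodFact : ∀ {j} → Vec ℕ j → ℕ
prodFact []       = 1
prodFact (c ∷ cs) = c ! * prodFact cs

prodFact≢0 : ∀ {j} (c : Vec ℕ j) → NonZero (prodFact c)
prodFact≢0 []       = _
prodFact≢0 (c ∷ cs) = m*n≢0 (c !) (prodFact cs) {{c !≢0}} {{prodFact≢0 cs}}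

multinomial : ∀ {j} → Vec ℕ j → ℚ
multinomial c = + (Vec.sum c !) / prodFact c
  where instance _ = prodFact≢0 c

invFactPow : ℕ → ℕ → ℚ
invFactPow s c = + 1 / ((s !) ^ c)
  where instance _ = m^n≢0 (s !) c {{s !≢0}}

prodInv : ∀ {j} → Vec ℕ j → Vec ℕ j → ℚ
prodInv []       []       = ℚ.1ℚ
prodInv (s ∷ ss) (c ∷ cs) = invFactPow s c ℚ.* prodInv ss cs

sumℚ : List ℚ → ℚ
sumℚ = List.foldr ℚ._+_ ℚ.0ℚ

rhs : (n : ℕ) → ∀ {j} → Vec ℕ j → ℚ
rhs n s = (+ (n !) / 1) ℚ.* sumℚ (List.map (λ c → multinomial c ℚ.* prodInv s c) (Cset n s))

-- Both sides equal G(n), the number of ordered set partitions of an n-element set into blocks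
-- with sizes in S: G(0) = 1 and G(m) = Σ_{s ∈ S, s ≤ m} (m choose s) G(m − s).
-- On the right, Pascal's rule for multinomial coefficients turns m! Σ_{c ∈ C} into exactly this
-- recursion.  On the left, whether a tuple is a Fubini ranking of type T2 depends only on its
-- profile, the numbers of occurrences of 1, …, n: a valid profile is a run of blocks (an entry
-- k ∈ S followed by k − 1 zeros) and then zeros.  A profile e is realised by multinomial(e)
-- tuples, and summing over valid profiles by splitting off the first block gives the recursion.

module Submission where

open import Defs
open import Data.Nat using (ℕ; _≤_)
open import Data.Integer using (+_)
open import Data.Rational using (_/_)
open import Data.Vec using (Vec)
open import Data.Vec.Relation.Unary.All using (All)
open import Data.Vec.Relation.Unary.Unique.Propositional using (Unique)
open import Relation.Binary.PropositionalEquality using (_≡_)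

open import Algebra.Bundles using (Ring)
open import Data.Bool using (Bool; true; false; if_then_else_; _∧_; _∨_)
open import Data.Empty using (⊥-elim)
open import Data.Fin using (Fin; zero; suc; toℕ)
import Data.Integer as ℤ
import Data.Integer.Properties as ℤ
open import Data.List as List using (List; []; _∷_; _++_; concatMap; applyUpTo; upTo; filter; length)
import Data.List.Relation.Unary.All as ListAll
open import Data.Nat as ℕ
  using (zero; suc; NonZero; _<_; _+_; _*_; _∸_; _!; _^_; _≟_; _≤?_; _<?_; z≤n; s≤s)
open import Data.Nat.Combinatorics using (_C_; nCk≡n!/k![n-k]!; k![n∸k]!∣n!)
open import Data.Nat.DivMod using (m*[n/m]≡n)
open import Data.Nat.Properties as ℕ using (_!≢0)
open import Data.Product using (_×_; _,_; proj₁; proj₂; Σ)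
open import Data.Rational as ℚ using (ℚ; 0ℚ; 1ℚ)
import Data.Rational.Properties as ℚ
open import Data.Rational.Solver using (module +-*-Solver)
open import Data.Rational.Unnormalised as ℚᵘ using (mkℚᵘ; *≡*)
import Data.Rational.Unnormalised.Properties as ℚᵘ
open import Data.Sum using (_⊎_; inj₁; inj₂)
open import Data.Vec as Vec using ([]; _∷_; [_]; lookup; replicate; zipWith; _[_]%=_)
open import Data.Vec.Membership.DecPropositional _≟_ using (_∈?_)
open import Data.Vec.Membership.Propositional using (_∈_)
open import Data.Vec.Properties using (lookup-replicate; zipWith-identityˡ)
open import Data.Vec.Relation.Unary.All as All using ([]; _∷_)
open import Data.Vec.Relation.Unary.All.Properties using (lookup⁺)
open import Data.Vec.Relation.Unary.AllPairs using ([]; _∷_)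
open import Data.Vec.Relation.Unary.Any as Any using (Any; here; there)
open import Function using (_∘_; id)
open import Relation.Binary.PropositionalEquality
  using (refl; sym; trans; cong; cong₂; subst; module ≡-Reasoning)
open import Relation.Nullary using (Dec; yes; no; does; ¬_)
open import Relation.Nullary.Decidable using (dec-true; dec-false)
open import Relation.Unary using (Pred; Decidable)

open import Algebra.Properties.Semiring.Sum (Ring.semiring ℚ.+-*-ring)
  using (sum-syntax; sum-cong-≗; ∑-distrib-+; *-distribˡ-sum; sum-replicate-zero)

-- Opaque, so that Agda never normalises these rationals (running gcd) when comparing terms;
-- their arithmetic goes through ℚᵘ.
opaque
  ι : ℕ → ℚ
  ι a = + a / 1

  recip : (d : ℕ) → .{{NonZero d}} → ℚ
  recip d = + 1 / d

  private
    toℚᵘ-/ : ∀ a k → ℚ.toℚᵘ (+ a / suc k) ℚᵘ.≃ mkℚᵘ (+ a) k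
    toℚᵘ-/ a k = ℚ.toℚᵘ-fromℚᵘ (mkℚᵘ (+ a) k)

  ι-+ : ∀ a b → ι (a + b) ≡ ι a ℚ.+ ι b
  ι-+ a b = ℚ.toℚᵘ-injective (begin
    ℚ.toℚᵘ (ι (a + b))               ≈⟨ toℚᵘ-/ (a + b) 0 ⟩
    mkℚᵘ (+ (a + b)) 0               ≈⟨ *≡* eq ⟩
    mkℚᵘ (+ a) 0 ℚᵘ.+ mkℚᵘ (+ b) 0   ≈⟨ ℚᵘ.+-cong (ℚᵘ.≃-sym (toℚᵘ-/ a 0)) (ℚᵘ.≃-sym (toℚᵘ-/ b 0)) ⟩
    ℚ.toℚᵘ (ι a) ℚᵘ.+ ℚ.toℚᵘ (ι b)   ≈⟨ ℚᵘ.≃-sym (ℚ.toℚᵘ-homo-+ (ι a) (ι b)) ⟩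
    ℚ.toℚᵘ (ι a ℚ.+ ι b)             ∎)
    where
    open ℚᵘ.≃-Reasoning
    eq : + (a + b) ℤ.* + 1 ≡ (+ a ℤ.* + 1 ℤ.+ + b ℤ.* + 1) ℤ.* + 1
    eq rewrite ℤ.*-identityʳ (+ a) | ℤ.*-identityʳ (+ b) | ℤ.*-identityʳ (+ (a + b)) = ℤ.pos-+ a b

  ι-* : ∀ a b → ι (a * b) ≡ ι a ℚ.* ι b
  ι-* a b = ℚ.toℚᵘ-injective (begin
    ℚ.toℚᵘ (ι (a * b))               ≈⟨ toℚᵘ-/ (a * b) 0 ⟩
    mkℚᵘ (+ (a * b)) 0               ≈⟨ *≡* (cong (ℤ._* + 1) (ℤ.pos-* a b)) ⟩
    mkℚᵘ (+ a) 0 ℚᵘ.* mkℚᵘ (+ b) 0   ≈⟨ ℚᵘ.*-cong (ℚᵘ.≃-sym (toℚᵘ-/ a 0)) (ℚᵘ.≃-sym (toℚᵘ-/ b 0)) ⟩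
    ℚ.toℚᵘ (ι a) ℚᵘ.* ℚ.toℚᵘ (ι b)   ≈⟨ ℚᵘ.≃-sym (ℚ.toℚᵘ-homo-* (ι a) (ι b)) ⟩
    ℚ.toℚᵘ (ι a ℚ.* ι b)             ∎)
    where open ℚᵘ.≃-Reasoning

  /≡ι*recip : ∀ a d .{{_ : NonZero d}} → + a / d ≡ ι a ℚ.* recip d
  /≡ι*recip a (suc k) = ℚ.toℚᵘ-injective (begin
    ℚ.toℚᵘ (+ a / suc k)                            ≈⟨ toℚᵘ-/ a k ⟩
    mkℚᵘ (+ a) k                                    ≈⟨ *≡* eq ⟩
    mkℚᵘ (+ a) 0 ℚᵘ.* mkℚᵘ (+ 1) k                  ≈⟨ ℚᵘ.*-cong (ℚᵘ.≃-sym (toℚᵘ-/ a 0)) (ℚᵘ.≃-sym (toℚᵘ-/ 1 k)) ⟩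
    ℚ.toℚᵘ (ι a) ℚᵘ.* ℚ.toℚᵘ (recip (suc k))        ≈⟨ ℚᵘ.≃-sym (ℚ.toℚᵘ-homo-* (ι a) (recip (suc k))) ⟩
    ℚ.toℚᵘ (ι a ℚ.* recip (suc k))                  ∎)
    where
    open ℚᵘ.≃-Reasoning
    eq : + a ℤ.* + suc (1 * k) ≡ (+ a ℤ.* + 1) ℤ.* + suc k
    eq rewrite ℤ.*-identityʳ (+ a) | ℕ.*-identityˡ k = refl

  recip-* : ∀ d e .{{_ : NonZero d}} .{{_ : NonZero e}} →
            recip (d * e) {{ℕ.m*n≢0 d e}} ≡ recip d ℚ.* recip e
  recip-* (suc k) (suc l) = ℚ.toℚᵘ-injective (begin
    ℚ.toℚᵘ (recip (suc k * suc l))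
      ≈⟨ toℚᵘ-/ 1 (l + k * suc l) ⟩
    mkℚᵘ (+ 1) (l + k * suc l)
      ≈⟨ *≡* refl ⟩
    mkℚᵘ (+ 1) k ℚᵘ.* mkℚᵘ (+ 1) l
      ≈⟨ ℚᵘ.*-cong (ℚᵘ.≃-sym (toℚᵘ-/ 1 k)) (ℚᵘ.≃-sym (toℚᵘ-/ 1 l)) ⟩
    ℚ.toℚᵘ (recip (suc k)) ℚᵘ.* ℚ.toℚᵘ (recip (suc l))
      ≈⟨ ℚᵘ.≃-sym (ℚ.toℚᵘ-homo-* (recip (suc k)) (recip (suc l))) ⟩
    ℚ.toℚᵘ (recip (suc k) ℚ.* recip (suc l)) ∎)
    where open ℚᵘ.≃-Reasoning

  ι*recip≡1 : ∀ d .{{_ : NonZero d}} → ι d ℚ.* recip d ≡ 1ℚ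
  ι*recip≡1 (suc k) = trans (sym (/≡ι*recip (suc k) (suc k))) (ℚ.toℚᵘ-injective (begin
    ℚ.toℚᵘ (+ suc k / suc k)   ≈⟨ toℚᵘ-/ (suc k) k ⟩
    mkℚᵘ (+ suc k) k           ≈⟨ *≡* (ℤ.*-comm (+ suc k) (+ 1)) ⟩
    mkℚᵘ (+ 1) 0               ≈⟨ ℚᵘ.≃-sym (toℚᵘ-/ 1 0) ⟩
    ℚ.toℚᵘ 1ℚ                  ∎))
    where open ℚᵘ.≃-Reasoning

  /1≡ι : ∀ a → + a / 1 ≡ ι a
  /1≡ι a = refl

  recip≡1/ : ∀ d .{{_ : NonZero d}} → recip d ≡ + 1 / d
  recip≡1/ d = refl

  ι-0 : ι 0 ≡ 0ℚ
  ι-0 = refl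

  ι-1 : ι 1 ≡ 1ℚ
  ι-1 = refl

when : Bool → ℚ → ℚ
when b q = if b then q else 0ℚ

whenᵈ : ∀ {P : Set} → Dec P → ℚ → ℚ
whenᵈ d = when (does d)

when-+ : ∀ b x y → when b (x ℚ.+ y) ≡ when b x ℚ.+ when b y
when-+ true  x y = refl
when-+ false x y = sym (ℚ.+-identityʳ 0ℚ)

when-* : ∀ b k x → when b (k ℚ.* x) ≡ k ℚ.* when b x
when-* true  k x = refl
when-* false k x = sym (ℚ.*-zeroʳ k)

when-0 : ∀ b → when b 0ℚ ≡ 0ℚ
when-0 true  = refl
when-0 false = refl

when-comm : ∀ b c x → when b (when c x) ≡ when c (when b x)
when-comm true  c     x = refl
when-comm false true  x = refl
when-comm false false x = refl

when-∧ : ∀ b c x → when (b ∧ c) x ≡ when b 1ℚ ℚ.* when c x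
when-∧ true  c x = sym (ℚ.*-identityˡ (when c x))
when-∧ false c x = sym (ℚ.*-zeroˡ (when c x))

when-∨ : ∀ b c x → (b ≡ true → c ≡ false) → when (b ∨ c) x ≡ when b x ℚ.+ when c x
when-∨ true  c     x excl rewrite excl refl = sym (ℚ.+-identityʳ x)
when-∨ false true  x excl = sym (ℚ.+-identityˡ x)
when-∨ false false x excl = sym (ℚ.+-identityˡ 0ℚ)

when-1* : ∀ b x → when b 1ℚ ℚ.* x ≡ when b x
when-1* true  x = ℚ.*-identityˡ x
when-1* false x = ℚ.*-zeroˡ x

does≡true⇒ : ∀ {P : Set} (d : Dec P) → does d ≡ true → P
does≡true⇒ (yes p) _ = p

∧≡true⇒ : ∀ {b c} → (b ∧ c) ≡ true → b ≡ true × c ≡ true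
∧≡true⇒ {true} {true} _ = refl , refl

does≡-⇔ : ∀ {P : Set} (d : Dec P) (c : Bool) → (P → c ≡ true) → (c ≡ true → P) → does d ≡ c
does≡-⇔ (yes p) c       f g = sym (f p)
does≡-⇔ (no ¬p) true    f g = ⊥-elim (¬p (g refl))
does≡-⇔ (no ¬p) false   f g = refl

whenᵈ-yes : ∀ {P : Set} (d : Dec P) → P → ∀ q → whenᵈ d q ≡ q
whenᵈ-yes (yes _) p  q = refl
whenᵈ-yes (no ¬p) p  q = ⊥-elim (¬p p)

whenᵈ-no : ∀ {P : Set} (d : Dec P) → ¬ P → ∀ q → whenᵈ d q ≡ 0ℚ
whenᵈ-no (yes p) ¬p q = ⊥-elim (¬p p)
whenᵈ-no (no _)  ¬p q = refl

whenᵈ-cong : ∀ {P : Set} (d : Dec P) {x y} → (P → x ≡ y) → whenᵈ d x ≡ whenᵈ d y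
whenᵈ-cong (yes p) eq = eq p
whenᵈ-cong (no _)  eq = refl

whenᵈ-⇔ : ∀ {P Q : Set} (d : Dec P) (e : Dec Q) → (P → Q) → (Q → P) →
          ∀ {x y} → (P → x ≡ y) → whenᵈ d x ≡ whenᵈ e y
whenᵈ-⇔ (yes p) (yes q) f g eq = eq p
whenᵈ-⇔ (yes p) (no ¬q) f g eq = ⊥-elim (¬q (f p))
whenᵈ-⇔ (no ¬p) (yes q) f g eq = ⊥-elim (¬p (g q))
whenᵈ-⇔ (no ¬p) (no ¬q) f g eq = refl

whenᵈ-× : ∀ {A B C : Set} (a : Dec A) (b : Dec B) (c : Dec C) → (A → B → C) → (C → A) → (C → B) →
          ∀ {x y} → (A → B → x ≡ y) → whenᵈ a (whenᵈ b x) ≡ whenᵈ c y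
whenᵈ-× (yes a) (yes b) (yes c) f g h eq = eq a b
whenᵈ-× (yes a) (yes b) (no ¬c) f g h eq = ⊥-elim (¬c (f a b))
whenᵈ-× (yes a) (no ¬b) (yes c) f g h eq = ⊥-elim (¬b (h c))
whenᵈ-× (yes a) (no ¬b) (no ¬c) f g h eq = refl
whenᵈ-× (no ¬a) b       (yes c) f g h eq = ⊥-elim (¬a (g c))
whenᵈ-× (no ¬a) b       (no ¬c) f g h eq = refl

∑-zero : ∀ n {f : Fin n → ℚ} → (∀ i → f i ≡ 0ℚ) → ∑[ i < n ] f i ≡ 0ℚ
∑-zero n eq = trans (sum-cong-≗ {n} eq) (sum-replicate-zero n)

∑ℕ< : ℕ → (ℕ → ℚ) → ℚ
∑ℕ< n f = ∑[ i < n ] f (toℕ i)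

∑ℕ<-cong : ∀ n {f g : ℕ → ℚ} → (∀ x → f x ≡ g x) → ∑ℕ< n f ≡ ∑ℕ< n g
∑ℕ<-cong n eq = sum-cong-≗ {n} (eq ∘ toℕ)

∑ℕ<-zero : ∀ n {f : ℕ → ℚ} → (∀ x → f x ≡ 0ℚ) → ∑ℕ< n f ≡ 0ℚ
∑ℕ<-zero n eq = ∑-zero n (eq ∘ toℕ)

∑ℕ<-last : ∀ n f → ∑ℕ< (suc n) f ≡ ∑ℕ< n f ℚ.+ f n
∑ℕ<-last zero    f = trans (ℚ.+-identityʳ (f 0)) (sym (ℚ.+-identityˡ (f 0)))
∑ℕ<-last (suc n) f = trans (cong (f 0 ℚ.+_) (∑ℕ<-last n (f ∘ suc))) (sym (ℚ.+-assoc (f 0) _ _))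

-- ∑level B w m F sums F c over the c ∈ {0,…,B}ʲ with weight w c = m; the guard
-- w * x ≤? m keeps the truncated subtraction m ∸ w * x honest.
∑level : ∀ {j} → ℕ → Vec ℕ j → ℕ → (Vec ℕ j → ℚ) → ℚ
∑level B []       m F = whenᵈ (m ≟ 0) (F [])
∑level B (w ∷ ws) m F =
  ∑ℕ< (suc B) λ x → whenᵈ (w * x ≤? m) (∑level B ws (m ∸ w * x) (F ∘ (x ∷_)))

∑level-+ : ∀ {j} B (w : Vec ℕ j) m F G →
           ∑level B w m (λ c → F c ℚ.+ G c) ≡ ∑level B w m F ℚ.+ ∑level B w m G
∑level-+ B []       m F G = when-+ (does (m ≟ 0)) (F []) (G [])
∑level-+ {suc j} B (w ∷ ws) m F G = trans
  (∑ℕ<-cong (suc B) λ x → trans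
    (cong (whenᵈ (w * x ≤? m)) (∑level-+ B ws (m ∸ w * x) (F ∘ (x ∷_)) (G ∘ (x ∷_))))
    (when-+ (does (w * x ≤? m)) (below F x) (below G x)))
  (∑-distrib-+ {suc B} (slice F ∘ toℕ) (slice G ∘ toℕ))
  where
  below slice : (Vec ℕ (suc j) → ℚ) → ℕ → ℚ
  below H x = ∑level B ws (m ∸ w * x) (H ∘ (x ∷_))
  slice H x = whenᵈ (w * x ≤? m) (below H x)

∑level-* : ∀ {j} B (w : Vec ℕ j) m k F → ∑level B w m (λ c → k ℚ.* F c) ≡ k ℚ.* ∑level B w m F
∑level-* B []       m k F = when-* (does (m ≟ 0)) k (F [])
∑level-* B (w ∷ ws) m k F = trans
  (∑ℕ<-cong (suc B) λ x → trans
    (cong (whenᵈ (w * x ≤? m)) (∑level-* B ws (m ∸ w * x) k (F ∘ (x ∷_))))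
    (when-* (does (w * x ≤? m)) k (below x)))
  (sym (*-distribˡ-sum {suc B} k (slice ∘ toℕ)))
  where
  below slice : ℕ → ℚ
  below x = ∑level B ws (m ∸ w * x) (F ∘ (x ∷_))
  slice x = whenᵈ (w * x ≤? m) (below x)

∑level-0 : ∀ {j} B (w : Vec ℕ j) m → ∑level B w m (λ _ → 0ℚ) ≡ 0ℚ
∑level-0 B []       m = when-0 (does (m ≟ 0))
∑level-0 B (w ∷ ws) m = ∑ℕ<-zero (suc B) λ x →
  trans (cong (whenᵈ (w * x ≤? m)) (∑level-0 B ws (m ∸ w * x))) (when-0 (does (w * x ≤? m)))

∑level-cong : ∀ {j} B (w : Vec ℕ j) m {F G} → (∀ c → weight w c ≡ m → F c ≡ G c) →
              ∑level B w m F ≡ ∑level B w m G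
∑level-cong B []       m eq = whenᵈ-cong (m ≟ 0) λ m≡0 → eq [] (sym m≡0)
∑level-cong B (w ∷ ws) m eq = ∑ℕ<-cong (suc B) λ x → whenᵈ-cong (w * x ≤? m) λ wx≤m →
  ∑level-cong B ws (m ∸ w * x) λ c wc≡ → eq (x ∷ c) (trans (cong (λ t → w * x + t) wc≡) (ℕ.m+[n∸m]≡n wx≤m))

∑level-∑ : ∀ {j} B (w : Vec ℕ j) m n (H : Fin n → Vec ℕ j → ℚ) →
           ∑level B w m (λ c → ∑[ i < n ] H i c) ≡ ∑[ i < n ] ∑level B w m (H i)
∑level-∑ B w m zero    H = ∑level-0 B w m
∑level-∑ B w m (suc n) H =
  trans (∑level-+ B w m _ _) (cong (∑level B w m (H zero) ℚ.+_) (∑level-∑ B w m n (H ∘ suc)))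

∑ℕ<-when : ∀ n b (f : ℕ → ℚ) → ∑ℕ< n (λ x → when b (f x)) ≡ when b (∑ℕ< n f)
∑ℕ<-when n true  f = refl
∑ℕ<-when n false f = ∑ℕ<-zero n (λ _ → refl)

guard-split : ∀ a b m (F : ℕ → ℚ) →
  whenᵈ (a + b ≤? m) (F (m ∸ (a + b))) ≡ whenᵈ (a ≤? m) (whenᵈ (b ≤? m ∸ a) (F (m ∸ a ∸ b)))
guard-split a b m F = sym (whenᵈ-× (a ≤? m) (b ≤? m ∸ a) (a + b ≤? m)
  (λ a≤m b≤m∸a → subst (_≤ m) (ℕ.+-comm b a) (ℕ.m≤o∸n⇒m+n≤o b a≤m b≤m∸a))
  (λ a+b≤m → ℕ.≤-trans (ℕ.m≤m+n a b) a+b≤m)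
  (λ a+b≤m → ℕ.m+n≤o⇒m≤o∸n b (subst (_≤ m) (ℕ.+-comm a b) a+b≤m))
  (λ _ _ → cong F (ℕ.∸-+-assoc m a b)))

guard-swap : ∀ a b m (F : ℕ → ℚ) →
  whenᵈ (a ≤? m) (whenᵈ (b ≤? m ∸ a) (F (m ∸ a ∸ b))) ≡
  whenᵈ (b ≤? m) (whenᵈ (a ≤? m ∸ b) (F (m ∸ b ∸ a)))
guard-swap a b m F = begin
  whenᵈ (a ≤? m) (whenᵈ (b ≤? m ∸ a) (F (m ∸ a ∸ b))) ≡⟨ guard-split a b m F ⟨
  whenᵈ (a + b ≤? m) (F (m ∸ (a + b)))                ≡⟨ cong (λ t → whenᵈ (t ≤? m) (F (m ∸ t))) (ℕ.+-comm a b) ⟩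
  whenᵈ (b + a ≤? m) (F (m ∸ (b + a)))                ≡⟨ guard-split b a m F ⟩
  whenᵈ (b ≤? m) (whenᵈ (a ≤? m ∸ b) (F (m ∸ b ∸ a))) ∎
  where open ≡-Reasoning

-- The substitution c = d + eᵢ: terms with cᵢ = 0 vanish, and m ≤ B makes the extra term
-- with dᵢ = B vanish.
∑level-shift : ∀ {j} B (w : Vec ℕ j) → All (1 ≤_) w → ∀ m → m ≤ B → (i : Fin j) (H : Vec ℕ j → ℚ) →
  ∑level B w m (λ c → ι (lookup c i) ℚ.* H c) ≡
  whenᵈ (lookup w i ≤? m) (∑level B w (m ∸ lookup w i) (λ d → ι (suc (lookup d i)) ℚ.* H (d [ i ]%= suc)))
∑level-shift B (w ∷ ws) (1≤w ∷ _) m m≤B zero H = begin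
  term 0 ℚ.+ ∑ℕ< B (term ∘ suc)                 ≡⟨ cong₂ ℚ._+_ term-0 (∑ℕ<-cong B term-suc) ⟩
  0ℚ ℚ.+ ∑ℕ< B (λ y → whenᵈ (w ≤? m) (g y))     ≡⟨ ℚ.+-identityˡ _ ⟩
  ∑ℕ< B (λ y → whenᵈ (w ≤? m) (g y))            ≡⟨ ∑ℕ<-when B (does (w ≤? m)) g ⟩
  whenᵈ (w ≤? m) (∑ℕ< B g)                      ≡⟨ whenᵈ-cong (w ≤? m) extend ⟩
  whenᵈ (w ≤? m) (∑ℕ< (suc B) g)                ∎
  where
  open ≡-Reasoning
  below : ℕ → ℕ → ℚ
  below x k = ∑level B ws k (λ c → ι x ℚ.* H (x ∷ c))
  term g : ℕ → ℚ
  term x = whenᵈ (w * x ≤? m) (below x (m ∸ w * x))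
  g y = whenᵈ (w * y ≤? m ∸ w) (below (suc y) (m ∸ w ∸ w * y))
  term-0 : term 0 ≡ 0ℚ
  term-0 = trans (cong (whenᵈ (w * 0 ≤? m)) (begin
    below 0 (m ∸ w * 0)     ≡⟨ ∑level-* B ws (m ∸ w * 0) (ι 0) (H ∘ (0 ∷_)) ⟩
    ι 0 ℚ.* rest            ≡⟨ cong (ℚ._* rest) ι-0 ⟩
    0ℚ ℚ.* rest             ≡⟨ ℚ.*-zeroˡ rest ⟩
    0ℚ                      ∎)) (when-0 (does (w * 0 ≤? m)))
    where
    rest : ℚ
    rest = ∑level B ws (m ∸ w * 0) (H ∘ (0 ∷_))
  term-suc : ∀ y → term (suc y) ≡ whenᵈ (w ≤? m) (g y)
  term-suc y = trans (cong (λ t → whenᵈ (t ≤? m) (below (suc y) (m ∸ t))) (ℕ.*-suc w y))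
                     (guard-split w (w * y) m (below (suc y)))
  extend : w ≤ m → ∑ℕ< B g ≡ ∑ℕ< (suc B) g
  extend w≤m = sym (begin
    ∑ℕ< (suc B) g        ≡⟨ ∑ℕ<-last B g ⟩
    ∑ℕ< B g ℚ.+ g B      ≡⟨ cong (∑ℕ< B g ℚ.+_) (whenᵈ-no (w * B ≤? m ∸ w) too-big _) ⟩
    ∑ℕ< B g ℚ.+ 0ℚ       ≡⟨ ℚ.+-identityʳ _ ⟩
    ∑ℕ< B g              ∎)
    where
    instance _ = ℕ.>-nonZero 1≤w
    too-big : ¬ w * B ≤ m ∸ w
    too-big le = ℕ.<-irrefl refl (ℕ.<-≤-trans (ℕ.∸-monoʳ-< {m} {w} {0} 1≤w w≤m)
                   (ℕ.≤-trans m≤B (ℕ.≤-trans (ℕ.m≤n*m B w) le)))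
∑level-shift B (w ∷ ws) (_ ∷ 1≤ws) m m≤B (suc i) H = begin
  ∑ℕ< (suc B) (λ x → whenᵈ (w * x ≤? m) (∑level B ws (m ∸ w * x) (λ c → ι (lookup c i) ℚ.* H (x ∷ c))))
    ≡⟨ ∑ℕ<-cong (suc B) (λ x → whenᵈ-cong (w * x ≤? m) λ _ →
         ∑level-shift B ws 1≤ws (m ∸ w * x) (ℕ.≤-trans (ℕ.m∸n≤m m (w * x)) m≤B) i (H ∘ (x ∷_))) ⟩
  ∑ℕ< (suc B) (λ x → whenᵈ (w * x ≤? m) (whenᵈ (wᵢ ≤? m ∸ w * x) (below x (m ∸ w * x ∸ wᵢ))))
    ≡⟨ ∑ℕ<-cong (suc B) (λ x → guard-swap (w * x) wᵢ m (below x)) ⟩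
  ∑ℕ< (suc B) (λ x → whenᵈ (wᵢ ≤? m) (whenᵈ (w * x ≤? m ∸ wᵢ) (below x (m ∸ wᵢ ∸ w * x))))
    ≡⟨ ∑ℕ<-when (suc B) (does (wᵢ ≤? m)) (λ x → whenᵈ (w * x ≤? m ∸ wᵢ) (below x (m ∸ wᵢ ∸ w * x))) ⟩
  whenᵈ (wᵢ ≤? m) (∑ℕ< (suc B) (λ x → whenᵈ (w * x ≤? m ∸ wᵢ) (below x (m ∸ wᵢ ∸ w * x)))) ∎
  where
  open ≡-Reasoning
  wᵢ : ℕ
  wᵢ = lookup ws i
  below : ℕ → ℕ → ℚ
  below x k = ∑level B ws k (λ d → ι (suc (lookup d i)) ℚ.* H (x ∷ (d [ i ]%= suc)))

reducedMultinomial : ∀ {j} → Vec ℕ j → ℚ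
reducedMultinomial c = + ((Vec.sum c ∸ 1) !) / prodFact c
  where instance _ = prodFact≢0 c

sum≡0⇒weight≡0 : ∀ {j} (w c : Vec ℕ j) → Vec.sum c ≡ 0 → weight w c ≡ 0
sum≡0⇒weight≡0 []       []      eq = refl
sum≡0⇒weight≡0 (w ∷ ws) (x ∷ c) eq
  rewrite ℕ.m+n≡0⇒m≡0 x eq | ℕ.*-zeroʳ w = sum≡0⇒weight≡0 ws c (ℕ.m+n≡0⇒n≡0 x eq)

n!/d≡n*[n∸1]!/d : ∀ s P .{{_ : NonZero P}} → 1 ≤ s → + (s !) / P ≡ ι s ℚ.* (+ ((s ∸ 1) !) / P)
n!/d≡n*[n∸1]!/d (suc k) P _ = begin
  + (suc k !) / P                       ≡⟨ /≡ι*recip (suc k !) P ⟩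
  ι (suc k * k !) ℚ.* recip P           ≡⟨ cong (ℚ._* recip P) (ι-* (suc k) (k !)) ⟩
  ι (suc k) ℚ.* ι (k !) ℚ.* recip P     ≡⟨ ℚ.*-assoc (ι (suc k)) (ι (k !)) (recip P) ⟩
  ι (suc k) ℚ.* (ι (k !) ℚ.* recip P)   ≡⟨ cong (ι (suc k) ℚ.*_) (/≡ι*recip (k !) P) ⟨
  ι (suc k) ℚ.* (+ (k !) / P)           ∎
  where open ≡-Reasoning

multinomial≡ι*reduced : ∀ {j} (c : Vec ℕ j) → 1 ≤ Vec.sum c →
                        multinomial c ≡ ι (Vec.sum c) ℚ.* reducedMultinomial c
multinomial≡ι*reduced c = n!/d≡n*[n∸1]!/d (Vec.sum c) (prodFact c) {{prodFact≢0 c}}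

∑ι-lookup : ∀ {j} (c : Vec ℕ j) → ∑[ i < j ] ι (lookup c i) ≡ ι (Vec.sum c)
∑ι-lookup []      = sym ι-0
∑ι-lookup (x ∷ c) = trans (cong (ι x ℚ.+_) (∑ι-lookup c)) (sym (ι-+ x (Vec.sum c)))

sum-[]%=suc : ∀ {j} (d : Vec ℕ j) i → Vec.sum (d [ i ]%= suc) ≡ suc (Vec.sum d)
sum-[]%=suc (x ∷ d) zero    = refl
sum-[]%=suc (x ∷ d) (suc i) = trans (cong (_+_ x) (sum-[]%=suc d i)) (ℕ.+-suc x (Vec.sum d))

prodFact-[]%=suc : ∀ {j} (d : Vec ℕ j) i → prodFact (d [ i ]%= suc) ≡ suc (lookup d i) * prodFact d
prodFact-[]%=suc (x ∷ d) zero    = ℕ.*-assoc (suc x) (x !) (prodFact d)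
prodFact-[]%=suc (x ∷ d) (suc i) = begin
  x ! * prodFact (d [ i ]%= suc)           ≡⟨ cong (x ! *_) (prodFact-[]%=suc d i) ⟩
  x ! * (suc (lookup d i) * prodFact d)    ≡⟨ ℕ.*-assoc (x !) (suc (lookup d i)) (prodFact d) ⟨
  x ! * suc (lookup d i) * prodFact d      ≡⟨ cong (_* prodFact d) (ℕ.*-comm (x !) (suc (lookup d i))) ⟩
  suc (lookup d i) * x ! * prodFact d      ≡⟨ ℕ.*-assoc (suc (lookup d i)) (x !) (prodFact d) ⟩
  suc (lookup d i) * (x ! * prodFact d)    ∎
  where open ≡-Reasoning

ι*/-cancel : ∀ a F P .{{_ : NonZero P}} → ι (suc a) ℚ.* ((+ F / (suc a * P)) {{ℕ.m*n≢0 (suc a) P}}) ≡ + F / P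
ι*/-cancel a F P = begin
  ι (suc a) ℚ.* (+ F / (suc a * P))                   ≡⟨ cong (ι (suc a) ℚ.*_) (/≡ι*recip F (suc a * P)) ⟩
  ι (suc a) ℚ.* (ι F ℚ.* recip (suc a * P))
    ≡⟨ cong (λ z → ι (suc a) ℚ.* (ι F ℚ.* z)) (recip-* (suc a) P) ⟩
  ι (suc a) ℚ.* (ι F ℚ.* (recip (suc a) ℚ.* recip P))
    ≡⟨ solve 4 (λ A X IA IP → A :* (X :* (IA :* IP)) := (A :* IA) :* (X :* IP)) refl
               (ι (suc a)) (ι F) (recip (suc a)) (recip P) ⟩
  (ι (suc a) ℚ.* recip (suc a)) ℚ.* (ι F ℚ.* recip P) ≡⟨ cong (ℚ._* (ι F ℚ.* recip P)) (ι*recip≡1 (suc a)) ⟩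
  1ℚ ℚ.* (ι F ℚ.* recip P)                            ≡⟨ ℚ.*-identityˡ _ ⟩
  ι F ℚ.* recip P                                     ≡⟨ /≡ι*recip F P ⟨
  + F / P                                             ∎
  where
  open ≡-Reasoning
  open +-*-Solver
  instance _ = ℕ.m*n≢0 (suc a) P

ι*reduced-[]%=suc : ∀ {j} (d : Vec ℕ j) i →
                    ι (suc (lookup d i)) ℚ.* reducedMultinomial (d [ i ]%= suc) ≡ multinomial d
ι*reduced-[]%=suc d i = trans
  (cong (ι (suc (lookup d i)) ℚ.*_)
    (ℚ./-cong {{prodFact≢0 (d [ i ]%= suc)}} {{ℕ.m*n≢0 (suc (lookup d i)) (prodFact d) {{_}} {{prodFact≢0 d}}}}
      (cong (λ z → + ((z ∸ 1) !)) (sum-[]%=suc d i)) (prodFact-[]%=suc d i)))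
  (ι*/-cancel (lookup d i) (Vec.sum d !) (prodFact d) {{prodFact≢0 d}})

-- Pascal's rule for multinomial coefficients, (|c| choose c) = Σᵢ (|c| − 1 choose c − eᵢ),
-- summed over a level set.
∑level-multinomial : ∀ {j} B (w : Vec ℕ j) → All (1 ≤_) w → ∀ m → 1 ≤ m → m ≤ B → (G : Vec ℕ j → ℚ) →
  ∑level B w m (λ c → multinomial c ℚ.* G c) ≡
  ∑[ i < j ] whenᵈ (lookup w i ≤? m) (∑level B w (m ∸ lookup w i) (λ d → multinomial d ℚ.* G (d [ i ]%= suc)))
∑level-multinomial {j} B w 1≤w m 1≤m m≤B G = begin
  ∑level B w m (λ c → multinomial c ℚ.* G c)
    ≡⟨ ∑level-cong B w m split ⟩
  ∑level B w m (λ c → ∑[ i < j ] (ι (lookup c i) ℚ.* R c))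
    ≡⟨ ∑level-∑ B w m j (λ i c → ι (lookup c i) ℚ.* R c) ⟩
  ∑[ i < j ] ∑level B w m (λ c → ι (lookup c i) ℚ.* R c)
    ≡⟨ sum-cong-≗ {j} (λ i → ∑level-shift B w 1≤w m m≤B i R) ⟩
  ∑[ i < j ] whenᵈ (lookup w i ≤? m) (∑level B w (m ∸ lookup w i) (λ d → ι (suc (lookup d i)) ℚ.* R (d [ i ]%= suc)))
    ≡⟨ sum-cong-≗ {j} (λ i → whenᵈ-cong (lookup w i ≤? m) λ _ → ∑level-cong B w (m ∸ lookup w i) λ d _ →
         trans (sym (ℚ.*-assoc (ι (suc (lookup d i))) _ _)) (cong (ℚ._* G (d [ i ]%= suc)) (ι*reduced-[]%=suc d i))) ⟩
  ∑[ i < j ] whenᵈ (lookup w i ≤? m) (∑level B w (m ∸ lookup w i) (λ d → multinomial d ℚ.* G (d [ i ]%= suc))) ∎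
  where
  open ≡-Reasoning
  R : Vec ℕ j → ℚ
  R c = reducedMultinomial c ℚ.* G c
  split : ∀ c → weight w c ≡ m → multinomial c ℚ.* G c ≡ ∑[ i < j ] (ι (lookup c i) ℚ.* R c)
  split c wc≡m = begin
    multinomial c ℚ.* G c                        ≡⟨ cong (ℚ._* G c) (multinomial≡ι*reduced c |c|≥1) ⟩
    ι (Vec.sum c) ℚ.* reducedMultinomial c ℚ.* G c ≡⟨ ℚ.*-assoc (ι (Vec.sum c)) _ _ ⟩
    ι (Vec.sum c) ℚ.* R c                        ≡⟨ cong (ℚ._* R c) (∑ι-lookup c) ⟨
    (∑[ i < j ] ι (lookup c i)) ℚ.* R c          ≡⟨ ℚ.*-comm (∑[ i < j ] ι (lookup c i)) (R c) ⟩
    R c ℚ.* (∑[ i < j ] ι (lookup c i))          ≡⟨ *-distribˡ-sum {j} (R c) (λ i → ι (lookup c i)) ⟩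
    ∑[ i < j ] (R c ℚ.* ι (lookup c i))            ≡⟨ sum-cong-≗ {j} (λ i → ℚ.*-comm (R c) (ι (lookup c i))) ⟩
    ∑[ i < j ] (ι (lookup c i) ℚ.* R c)            ∎
    where
    |c|≥1 : 1 ≤ Vec.sum c
    |c|≥1 = ℕ.n≢0⇒n>0 λ |c|≡0 → ℕ.<⇒≢ 1≤m (trans (sym (sum≡0⇒weight≡0 w c |c|≡0)) wc≡m)

∑ₗ : ∀ {A : Set} → List A → (A → ℚ) → ℚ
∑ₗ xs f = sumℚ (List.map f xs)

∑ₗ-cong-All : ∀ {A : Set} {P : A → Set} (xs : List A) → ListAll.All P xs →
              ∀ {f g : A → ℚ} → (∀ x → P x → f x ≡ g x) → ∑ₗ xs f ≡ ∑ₗ xs g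
∑ₗ-cong-All []       _                  eq = refl
∑ₗ-cong-All (x ∷ xs) (px ListAll.∷ pxs) eq = cong₂ ℚ._+_ (eq x px) (∑ₗ-cong-All xs pxs eq)

∑ₗ-cong : ∀ {A : Set} (xs : List A) {f g : A → ℚ} → (∀ x → f x ≡ g x) → ∑ₗ xs f ≡ ∑ₗ xs g
∑ₗ-cong []       eq = refl
∑ₗ-cong (x ∷ xs) eq = cong₂ ℚ._+_ (eq x) (∑ₗ-cong xs eq)

∑ₗ-when : ∀ {A : Set} (xs : List A) b f → ∑ₗ xs (λ x → when b (f x)) ≡ when b (∑ₗ xs f)
∑ₗ-when xs       true  f = refl
∑ₗ-when []       false f = refl
∑ₗ-when (x ∷ xs) false f = trans (ℚ.+-identityˡ _) (∑ₗ-when xs false f)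

∑ₗ-++ : ∀ {A : Set} (xs ys : List A) f → ∑ₗ (xs ++ ys) f ≡ ∑ₗ xs f ℚ.+ ∑ₗ ys f
∑ₗ-++ []       ys f = sym (ℚ.+-identityˡ _)
∑ₗ-++ (x ∷ xs) ys f =
  trans (cong (f x ℚ.+_) (∑ₗ-++ xs ys f)) (sym (ℚ.+-assoc (f x) (∑ₗ xs f) (∑ₗ ys f)))

∑ₗ-concatMap : ∀ {A B : Set} (g : A → List B) xs f → ∑ₗ (concatMap g xs) f ≡ ∑ₗ xs (λ x → ∑ₗ (g x) f)
∑ₗ-concatMap g []       f = refl
∑ₗ-concatMap g (x ∷ xs) f =
  trans (∑ₗ-++ (g x) (concatMap g xs) f) (cong (∑ₗ (g x) f ℚ.+_) (∑ₗ-concatMap g xs f))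

∑ₗ-map : ∀ {A B : Set} (g : A → B) xs f → ∑ₗ (List.map g xs) f ≡ ∑ₗ xs (f ∘ g)
∑ₗ-map g []       f = refl
∑ₗ-map g (x ∷ xs) f = cong (f (g x) ℚ.+_) (∑ₗ-map g xs f)

∑ₗ-applyUpTo : ∀ {A : Set} (g : ℕ → A) n f → ∑ₗ (applyUpTo g n) f ≡ ∑ℕ< n (f ∘ g)
∑ₗ-applyUpTo g zero    f = refl
∑ₗ-applyUpTo g (suc n) f = cong (f (g 0) ℚ.+_) (∑ₗ-applyUpTo (g ∘ suc) n f)

∑ₗ-filter : ∀ {A : Set} {P : Pred A _} (P? : Decidable P) xs f →
            ∑ₗ (filter P? xs) f ≡ ∑ₗ xs (λ x → whenᵈ (P? x) (f x))
∑ₗ-filter P? []       f = refl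
∑ₗ-filter P? (x ∷ xs) f with P? x
... | yes _ = cong (f x ℚ.+_) (∑ₗ-filter P? xs f)
... | no  _ = trans (∑ₗ-filter P? xs f) (sym (ℚ.+-identityˡ _))

ι-length-filter : ∀ {A : Set} {P : Pred A _} (P? : Decidable P) xs →
                  ι (length (filter P? xs)) ≡ ∑ₗ xs (λ x → whenᵈ (P? x) 1ℚ)
ι-length-filter P? []       = ι-0
ι-length-filter P? (x ∷ xs) with P? x
... | yes _ = trans (ι-+ 1 (length (filter P? xs))) (cong₂ ℚ._+_ ι-1 (ι-length-filter P? xs))
... | no  _ = trans (ι-length-filter P? xs) (sym (ℚ.+-identityˡ _))

∑ₗ-tuples-cong : ∀ {P : ℕ → Set} (vs : List ℕ) → ListAll.All P vs → ∀ m {f g : Vec ℕ m → ℚ} →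
                 (∀ b → All P b → f b ≡ g b) → ∑ₗ (tuples vs m) f ≡ ∑ₗ (tuples vs m) g
∑ₗ-tuples-cong vs _   zero    eq = cong (ℚ._+ 0ℚ) (eq [] [])
∑ₗ-tuples-cong vs pvs (suc m) {f} {g} eq = begin
  ∑ₗ (concatMap extend vs) f           ≡⟨ ∑ₗ-concatMap extend vs f ⟩
  ∑ₗ vs (λ x → ∑ₗ (extend x) f)        ≡⟨ ∑ₗ-cong-All vs pvs (λ x px → begin
      ∑ₗ (extend x) f                      ≡⟨ ∑ₗ-map (x ∷_) (tuples vs m) f ⟩
      ∑ₗ (tuples vs m) (f ∘ (x ∷_))        ≡⟨ ∑ₗ-tuples-cong vs pvs m (λ b pb → eq (x ∷ b) (px ∷ pb)) ⟩
      ∑ₗ (tuples vs m) (g ∘ (x ∷_))        ≡⟨ ∑ₗ-map (x ∷_) (tuples vs m) g ⟨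
      ∑ₗ (extend x) g                      ∎) ⟩
  ∑ₗ vs (λ x → ∑ₗ (extend x) g)        ≡⟨ ∑ₗ-concatMap extend vs g ⟨
  ∑ₗ (concatMap extend vs) g           ∎
  where
  open ≡-Reasoning
  extend : ℕ → List (Vec ℕ (suc m))
  extend x = List.map (x ∷_) (tuples vs m)

guard-≟-split : ∀ a t m q → whenᵈ (a + t ≟ m) q ≡ whenᵈ (a ≤? m) (whenᵈ (t ≟ m ∸ a) q)
guard-≟-split a t m q with a ≤? m
... | yes a≤m = trans
  (whenᵈ-⇔ (a + t ≟ m) (t ≟ m ∸ a)
    (λ e → trans (sym (ℕ.m+n∸m≡n a t)) (cong (_∸ a) e))
    (λ e → trans (cong (_+_ a) e) (ℕ.m+[n∸m]≡n a≤m)) (λ _ → refl))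
  (sym (whenᵈ-yes (a ≤? m) a≤m _))
... | no  a≰m = trans
  (whenᵈ-no (a + t ≟ m) (λ e → a≰m (subst (a ≤_) e (ℕ.m≤m+n a t))) q)
  (sym (whenᵈ-no (a ≤? m) a≰m _))

∑ₗ-tuples-weight : ∀ {j} B (w : Vec ℕ j) m F →
  ∑ₗ (tuples (upTo (suc B)) j) (λ c → whenᵈ (weight w c ≟ m) (F c)) ≡ ∑level B w m F
∑ₗ-tuples-weight B []       m F = trans (ℚ.+-identityʳ _) (whenᵈ-⇔ (0 ≟ m) (m ≟ 0) sym sym (λ _ → refl))
∑ₗ-tuples-weight {suc j} B (w ∷ ws) m F = begin
  ∑ₗ (concatMap extend (upTo (suc B))) G      ≡⟨ ∑ₗ-concatMap extend (upTo (suc B)) G ⟩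
  ∑ₗ (upTo (suc B)) (λ x → ∑ₗ (extend x) G)   ≡⟨ ∑ₗ-applyUpTo id (suc B) (λ x → ∑ₗ (extend x) G) ⟩
  ∑ℕ< (suc B) (λ x → ∑ₗ (extend x) G)         ≡⟨ ∑ℕ<-cong (suc B) slice ⟩
  ∑level B (w ∷ ws) m F                       ∎
  where
  open ≡-Reasoning
  T : List (Vec ℕ j)
  T = tuples (upTo (suc B)) j
  extend : ℕ → List (Vec ℕ (suc j))
  extend x = List.map (x ∷_) T
  G : Vec ℕ (suc j) → ℚ
  G c = whenᵈ (weight (w ∷ ws) c ≟ m) (F c)
  slice : ∀ x → ∑ₗ (extend x) G ≡ whenᵈ (w * x ≤? m) (∑level B ws (m ∸ w * x) (F ∘ (x ∷_)))
  slice x = begin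
    ∑ₗ (extend x) G
      ≡⟨ ∑ₗ-map (x ∷_) T G ⟩
    ∑ₗ T (λ c → whenᵈ (w * x + weight ws c ≟ m) (F (x ∷ c)))
      ≡⟨ ∑ₗ-cong T (λ c → guard-≟-split (w * x) (weight ws c) m (F (x ∷ c))) ⟩
    ∑ₗ T (λ c → whenᵈ (w * x ≤? m) (whenᵈ (weight ws c ≟ m ∸ w * x) (F (x ∷ c))))
      ≡⟨ ∑ₗ-when T (does (w * x ≤? m)) (λ c → whenᵈ (weight ws c ≟ m ∸ w * x) (F (x ∷ c))) ⟩
    whenᵈ (w * x ≤? m) (∑ₗ T (λ c → whenᵈ (weight ws c ≟ m ∸ w * x) (F (x ∷ c))))
      ≡⟨ cong (whenᵈ (w * x ≤? m)) (∑ₗ-tuples-weight B ws (m ∸ w * x) (F ∘ (x ∷_))) ⟩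
    whenᵈ (w * x ≤? m) (∑level B ws (m ∸ w * x) (F ∘ (x ∷_))) ∎

∑level-at-0 : ∀ {j} B (w : Vec ℕ j) → All (1 ≤_) w → ∀ F → ∑level B w 0 F ≡ F (replicate j 0)
∑level-at-0 B []       _           F = refl
∑level-at-0 {suc j} B (w ∷ ws) (1≤w ∷ 1≤ws) F = begin
  whenᵈ (w * 0 ≤? 0) (∑level B ws (0 ∸ w * 0) (F ∘ (0 ∷_))) ℚ.+ ∑ℕ< B (term ∘ suc)
    ≡⟨ cong₂ ℚ._+_ (cong (λ z → whenᵈ (z ≤? 0) (∑level B ws (0 ∸ z) (F ∘ (0 ∷_)))) (ℕ.*-zeroʳ w))
                   (∑ℕ<-zero B λ y → whenᵈ-no (w * suc y ≤? 0) (positive y) (below (suc y))) ⟩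
  ∑level B ws 0 (F ∘ (0 ∷_)) ℚ.+ 0ℚ  ≡⟨ ℚ.+-identityʳ _ ⟩
  ∑level B ws 0 (F ∘ (0 ∷_))         ≡⟨ ∑level-at-0 B ws 1≤ws (F ∘ (0 ∷_)) ⟩
  F (replicate (suc j) 0)            ∎
  where
  open ≡-Reasoning
  below term : ℕ → ℚ
  below x = ∑level B ws (0 ∸ w * x) (F ∘ (x ∷_))
  term x = whenᵈ (w * x ≤? 0) (below x)
  positive : ∀ y → ¬ w * suc y ≤ 0
  positive y le = ℕ.<-irrefl refl (ℕ.<-≤-trans 1≤w (ℕ.≤-trans (ℕ.m≤m*n w (suc y)) le))

multinomial-zeros : ∀ j → multinomial (replicate j 0) ≡ 1ℚ
multinomial-zeros j =
  ℚ./-cong {{prodFact≢0 (replicate j 0)}} (cong (λ z → + (z !)) (sum-zeros j)) (prodFact-zeros j)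
  where
  sum-zeros : ∀ j → Vec.sum (replicate j 0) ≡ 0
  sum-zeros zero    = refl
  sum-zeros (suc j) = sum-zeros j
  prodFact-zeros : ∀ j → prodFact (replicate j 0) ≡ 1
  prodFact-zeros zero    = refl
  prodFact-zeros (suc j) = trans (ℕ.*-identityˡ _) (prodFact-zeros j)

prodInv-zeros : ∀ {j} (S : Vec ℕ j) → prodInv S (replicate j 0) ≡ 1ℚ
prodInv-zeros []      = refl
prodInv-zeros (s ∷ S) = trans (ℚ.*-identityˡ _) (prodInv-zeros S)

invFactPow-suc : ∀ s c → invFactPow s (suc c) ≡ recip (s !) {{s !≢0}} ℚ.* invFactPow s c
invFactPow-suc s c = trans
  (sym (recip≡1/ ((s !) ^ suc c) {{ℕ.m^n≢0 (s !) (suc c) {{s !≢0}}}}))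
  (trans (recip-* (s !) ((s !) ^ c) {{s !≢0}} {{ℕ.m^n≢0 (s !) c {{s !≢0}}}})
         (cong (recip (s !) {{s !≢0}} ℚ.*_) (recip≡1/ ((s !) ^ c) {{ℕ.m^n≢0 (s !) c {{s !≢0}}}})))

prodInv-[]%=suc : ∀ {j} (S : Vec ℕ j) d i →
                  prodInv S (d [ i ]%= suc) ≡ prodInv S d ℚ.* recip (lookup S i !) {{lookup S i !≢0}}
prodInv-[]%=suc (s ∷ S) (x ∷ d) zero = begin
  invFactPow s (suc x) ℚ.* prodInv S d           ≡⟨ cong (ℚ._* prodInv S d) (invFactPow-suc s x) ⟩
  I ℚ.* invFactPow s x ℚ.* prodInv S d           ≡⟨ ℚ.*-assoc I (invFactPow s x) (prodInv S d) ⟩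
  I ℚ.* (invFactPow s x ℚ.* prodInv S d)         ≡⟨ ℚ.*-comm I (invFactPow s x ℚ.* prodInv S d) ⟩
  invFactPow s x ℚ.* prodInv S d ℚ.* I           ∎
  where
  open ≡-Reasoning
  I : ℚ
  I = recip (s !) {{s !≢0}}
prodInv-[]%=suc (s ∷ S) (x ∷ d) (suc i) = trans
  (cong (invFactPow s x ℚ.*_) (prodInv-[]%=suc S d i))
  (sym (ℚ.*-assoc (invFactPow s x) (prodInv S d) (recip (lookup S i !) {{lookup S i !≢0}})))

ι!*recip!≡ιC*ι! : ∀ n s → s ≤ n → ι (n !) ℚ.* recip (s !) {{s !≢0}} ≡ ι (n C s) ℚ.* ι ((n ∸ s) !)
ι!*recip!≡ιC*ι! n s s≤n = begin
  ι (n !) ℚ.* I                                      ≡⟨ cong (λ z → ι z ℚ.* I) n!≡ ⟨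
  ι (s ! * (n ∸ s) ! * (n C s)) ℚ.* I
    ≡⟨ cong (ℚ._* I) (trans (ι-* _ _) (cong (ℚ._* ι (n C s)) (ι-* _ _))) ⟩
  ι (s !) ℚ.* ι ((n ∸ s) !) ℚ.* ι (n C s) ℚ.* I
    ≡⟨ solve 4 (λ a b c i → a :* b :* c :* i := (a :* i) :* (c :* b)) refl (ι (s !)) (ι ((n ∸ s) !)) (ι (n C s)) I ⟩
  (ι (s !) ℚ.* I) ℚ.* (ι (n C s) ℚ.* ι ((n ∸ s) !))
    ≡⟨ cong (ℚ._* (ι (n C s) ℚ.* ι ((n ∸ s) !))) (ι*recip≡1 (s !) {{s !≢0}}) ⟩
  1ℚ ℚ.* (ι (n C s) ℚ.* ι ((n ∸ s) !))               ≡⟨ ℚ.*-identityˡ _ ⟩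
  ι (n C s) ℚ.* ι ((n ∸ s) !)                        ∎
  where
  open ≡-Reasoning
  open +-*-Solver
  I : ℚ
  I = recip (s !) {{s !≢0}}
  instance _ = ℕ.m*n≢0 (s !) ((n ∸ s) !) {{s !≢0}} {{(n ∸ s) !≢0}}
  n!≡ : s ! * (n ∸ s) ! * (n C s) ≡ n !
  n!≡ = trans (cong (s ! * (n ∸ s) ! *_) (nCk≡n!/k![n-k]! s≤n)) (m*[n/m]≡n (k![n∸k]!∣n! s≤n))

-- The number of ordered set partitions of an m-element set into blocks with sizes in S,
-- counted by choosing the first block; the fuel f only needs to be at least m.
orderedPartitionsᶠ : ∀ {j} → Vec ℕ j → ℕ → ℕ → ℚ
orderedPartitionsᶠ S zero m = 1ℚ
orderedPartitionsᶠ {j} S (suc f) m = whenᵈ (m ≟ 0) 1ℚ ℚ.+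
  ∑[ i < j ] whenᵈ (lookup S i ≤? m) (ι (m C lookup S i) ℚ.* orderedPartitionsᶠ S f (m ∸ lookup S i))

orderedPartitions : ∀ {j} → Vec ℕ j → ℕ → ℚ
orderedPartitions S m = orderedPartitionsᶠ S m m

module _ {j} (S : Vec ℕ j) (1≤S : All (1 ≤_) S) where

  no-block-fits-0 : ∀ (F : Fin j → ℚ) → ∑[ i < j ] whenᵈ (lookup S i ≤? 0) (F i) ≡ 0ℚ
  no-block-fits-0 F = ∑-zero j λ i →
    whenᵈ-no (lookup S i ≤? 0) (λ sᵢ≤0 → ℕ.<-irrefl refl (ℕ.<-≤-trans (lookup⁺ 1≤S i) sᵢ≤0)) (F i)

  orderedPartitionsᶠ-fuel : ∀ f f' m → m ≤ f → m ≤ f' → orderedPartitionsᶠ S f m ≡ orderedPartitionsᶠ S f' m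
  orderedPartitionsᶠ-fuel zero    zero     m  _   _   = refl
  orderedPartitionsᶠ-fuel zero    (suc f') .0 z≤n _   = sym (trans (cong (1ℚ ℚ.+_) (no-block-fits-0 _)) (ℚ.+-identityʳ 1ℚ))
  orderedPartitionsᶠ-fuel (suc f) zero     .0 _   z≤n = trans (cong (1ℚ ℚ.+_) (no-block-fits-0 _)) (ℚ.+-identityʳ 1ℚ)
  orderedPartitionsᶠ-fuel (suc f) (suc f') m  m≤f m≤f' =
    cong (whenᵈ (m ≟ 0) 1ℚ ℚ.+_) (sum-cong-≗ {j} λ i → whenᵈ-cong (lookup S i ≤? m) λ _ →
      cong (ι (m C lookup S i) ℚ.*_) (orderedPartitionsᶠ-fuel f f' (m ∸ lookup S i) (rest m≤f i) (rest m≤f' i)))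
    where
    rest : ∀ {g} → m ≤ suc g → ∀ i → m ∸ lookup S i ≤ g
    rest m≤g i = ℕ.≤-trans (ℕ.∸-monoʳ-≤ m (lookup⁺ 1≤S i)) (ℕ.∸-monoˡ-≤ 1 m≤g)

  orderedPartitions-unfold : ∀ m →
    whenᵈ (m ≟ 0) 1ℚ ℚ.+ ∑[ i < j ] whenᵈ (lookup S i ≤? m)
                                      (ι (m C lookup S i) ℚ.* orderedPartitions S (m ∸ lookup S i))
    ≡ orderedPartitions S m
  orderedPartitions-unfold zero     = trans (cong (1ℚ ℚ.+_) (no-block-fits-0 _)) (ℚ.+-identityʳ 1ℚ)
  orderedPartitions-unfold (suc m') =
    cong (0ℚ ℚ.+_) (sum-cong-≗ {j} λ i → whenᵈ-cong (lookup S i ≤? suc m') λ _ →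
      cong (ι (suc m' C lookup S i) ℚ.*_)
        (orderedPartitionsᶠ-fuel (suc m' ∸ lookup S i) m' (suc m' ∸ lookup S i) ℕ.≤-refl
          (ℕ.∸-monoʳ-≤ (suc m') (lookup⁺ 1≤S i))))

  rhsSum : ℕ → ℕ → ℚ
  rhsSum B m = ∑level B S m (λ c → multinomial c ℚ.* prodInv S c)

  rhsSum-0 : ∀ B → rhsSum B 0 ≡ 1ℚ
  rhsSum-0 B = trans (∑level-at-0 B S 1≤S _) (cong₂ ℚ._*_ (multinomial-zeros j) (prodInv-zeros S))

  rhsSum-rec : ∀ B m → 1 ≤ m → m ≤ B → rhsSum B m ≡
    ∑[ i < j ] whenᵈ (lookup S i ≤? m) (recip (lookup S i !) {{lookup S i !≢0}} ℚ.* rhsSum B (m ∸ lookup S i))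
  rhsSum-rec B m 1≤m m≤B = trans
    (∑level-multinomial B S 1≤S m 1≤m m≤B (prodInv S))
    (sum-cong-≗ {j} λ i → whenᵈ-cong (lookup S i ≤? m) λ _ → trans
      (∑level-cong B S (m ∸ lookup S i) λ d _ → trans
        (cong (multinomial d ℚ.*_) (prodInv-[]%=suc S d i))
        (trans (sym (ℚ.*-assoc (multinomial d) (prodInv S d) (I i)))
               (ℚ.*-comm (multinomial d ℚ.* prodInv S d) (I i))))
      (∑level-* B S (m ∸ lookup S i) (I i) (λ c → multinomial c ℚ.* prodInv S c)))
    where
    I : Fin j → ℚ
    I i = recip (lookup S i !) {{lookup S i !≢0}}

  -- k bounds m, so that the recursion on m ∸ sᵢ is structural
  ι!*rhsSum≡orderedPartitions : ∀ B k m → m ≤ k → m ≤ B → ι (m !) ℚ.* rhsSum B m ≡ orderedPartitions S m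
  ι!*rhsSum≡orderedPartitions B k zero _ _ = trans (cong₂ ℚ._*_ ι-1 (rhsSum-0 B)) (ℚ.*-identityˡ 1ℚ)
  ι!*rhsSum≡orderedPartitions B (suc k) (suc m) (s≤s m≤k) 1+m≤B = begin
    ι (suc m !) ℚ.* rhsSum B (suc m)
      ≡⟨ cong (ι (suc m !) ℚ.*_) (rhsSum-rec B (suc m) (s≤s z≤n) 1+m≤B) ⟩
    ι (suc m !) ℚ.* (∑[ i < j ] whenᵈ (lookup S i ≤? suc m) (I i ℚ.* rhsSum B (suc m ∸ lookup S i)))
      ≡⟨ *-distribˡ-sum {j} (ι (suc m !)) _ ⟩
    ∑[ i < j ] (ι (suc m !) ℚ.* whenᵈ (lookup S i ≤? suc m) (I i ℚ.* rhsSum B (suc m ∸ lookup S i)))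
      ≡⟨ sum-cong-≗ {j} term ⟩
    ∑[ i < j ] whenᵈ (lookup S i ≤? suc m) (ι (suc m C lookup S i) ℚ.* orderedPartitions S (suc m ∸ lookup S i))
      ≡⟨ ℚ.+-identityˡ _ ⟨
    0ℚ ℚ.+ ∑[ i < j ] whenᵈ (lookup S i ≤? suc m) (ι (suc m C lookup S i) ℚ.* orderedPartitions S (suc m ∸ lookup S i))
      ≡⟨ orderedPartitions-unfold (suc m) ⟩
    orderedPartitions S (suc m) ∎
    where
    open ≡-Reasoning
    I : Fin j → ℚ
    I i = recip (lookup S i !) {{lookup S i !≢0}}
    term : ∀ i → ι (suc m !) ℚ.* whenᵈ (lookup S i ≤? suc m) (I i ℚ.* rhsSum B (suc m ∸ lookup S i)) ≡
                 whenᵈ (lookup S i ≤? suc m) (ι (suc m C lookup S i) ℚ.* orderedPartitions S (suc m ∸ lookup S i))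
    term i = trans (sym (when-* (does (s ≤? suc m)) (ι (suc m !)) (I i ℚ.* rhsSum B (suc m ∸ s))))
      (whenᵈ-cong (s ≤? suc m) λ s≤1+m → begin
        ι (suc m !) ℚ.* (I i ℚ.* rhsSum B (suc m ∸ s))             ≡⟨ ℚ.*-assoc (ι (suc m !)) (I i) _ ⟨
        ι (suc m !) ℚ.* I i ℚ.* rhsSum B (suc m ∸ s)
          ≡⟨ cong (ℚ._* rhsSum B (suc m ∸ s)) (ι!*recip!≡ιC*ι! (suc m) s s≤1+m) ⟩
        ι (suc m C s) ℚ.* ι ((suc m ∸ s) !) ℚ.* rhsSum B (suc m ∸ s) ≡⟨ ℚ.*-assoc (ι (suc m C s)) _ _ ⟩
        ι (suc m C s) ℚ.* (ι ((suc m ∸ s) !) ℚ.* rhsSum B (suc m ∸ s))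
          ≡⟨ cong (ι (suc m C s) ℚ.*_) (ι!*rhsSum≡orderedPartitions B k (suc m ∸ s)
               (ℕ.≤-trans (ℕ.∸-monoʳ-≤ (suc m) (lookup⁺ 1≤S i)) m≤k) (ℕ.≤-trans (ℕ.m∸n≤m (suc m) s) 1+m≤B)) ⟩
        ι (suc m C s) ℚ.* orderedPartitions S (suc m ∸ s)         ∎)
      where
      s : ℕ
      s = lookup S i

  rhs≡orderedPartitions : ∀ n → rhs n S ≡ orderedPartitions S n
  rhs≡orderedPartitions n = trans
    (cong₂ ℚ._*_ (/1≡ι (n !))
      (trans (∑ₗ-filter (λ c → weight S c ≟ n) (tuples (upTo (suc n)) j) _)
             (∑ₗ-tuples-weight n S n (λ c → multinomial c ℚ.* prodInv S c))))
    (ι!*rhsSum≡orderedPartitions n n n ℕ.≤-refl ℕ.≤-refl)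

replicate-1≥1 : ∀ r → All (1 ≤_) (replicate r 1)
replicate-1≥1 zero    = []
replicate-1≥1 (suc r) = ℕ.≤-refl ∷ replicate-1≥1 r

valuesFrom : ℕ → ℕ → List ℕ
valuesFrom a zero    = []
valuesFrom a (suc r) = a ∷ valuesFrom (suc a) r

profile : ∀ {k} → ℕ → (r : ℕ) → Vec ℕ k → Vec ℕ r
profile a zero    b = []
profile a (suc r) b = occ a b ∷ profile (suc a) r b

profile-[] : ∀ a r → profile a r [] ≡ replicate r 0
profile-[] a zero    = refl
profile-[] a (suc r) = cong (0 ∷_) (profile-[] (suc a) r)

profile-∷ : ∀ {k} a r x (b : Vec ℕ k) → profile a r (x ∷ b) ≡ zipWith _+_ (profile a r [ x ]) (profile a r b)
profile-∷ a zero    x b = refl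
profile-∷ a (suc r) x b = cong₂ _∷_ (step (does (x ≟ a))) (profile-∷ (suc a) r x b)
  where
  step : ∀ t → (if t then suc else id) (occ a b) ≡ (if t then suc else id) 0 + occ a b
  step true  = refl
  step false = refl

profile-[x]-below : ∀ a r x → x < a → profile a r [ x ] ≡ replicate r 0
profile-[x]-below a zero    x x<a = refl
profile-[x]-below a (suc r) x x<a =
  cong₂ _∷_ (cong (λ t → (if t then suc else id) 0) (dec-false (x ≟ a) (ℕ.<⇒≢ x<a)))
            (profile-[x]-below (suc a) r x (ℕ.m<n⇒m<1+n x<a))

∑ₗ-valuesFrom-cong : ∀ a r {f g : ℕ → ℚ} → (∀ x → a ≤ x → f x ≡ g x) →
                     ∑ₗ (valuesFrom a r) f ≡ ∑ₗ (valuesFrom a r) g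
∑ₗ-valuesFrom-cong a zero    eq = refl
∑ₗ-valuesFrom-cong a (suc r) eq =
  cong₂ ℚ._+_ (eq a ℕ.≤-refl) (∑ₗ-valuesFrom-cong (suc a) r (λ x a<x → eq x (ℕ.<⇒≤ a<x)))

∑ₗ-profile-singleton : ∀ a r (ψ : Vec ℕ r → ℚ) →
  ∑ₗ (valuesFrom a r) (λ x → ψ (profile a r [ x ])) ≡ ∑[ i < r ] ψ (replicate r 0 [ i ]%= suc)
∑ₗ-profile-singleton a zero    ψ = refl
∑ₗ-profile-singleton a (suc r) ψ = cong₂ ℚ._+_
  (trans (cong (λ t → ψ ((if t then suc else id) 0 ∷ profile (suc a) r [ a ])) (dec-true (a ≟ a) refl))
         (cong (λ u → ψ (1 ∷ u)) (profile-[x]-below (suc a) r a (ℕ.n<1+n a))))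
  (trans (∑ₗ-valuesFrom-cong (suc a) r λ x a<x →
            cong (λ t → ψ ((if t then suc else id) 0 ∷ profile (suc a) r [ x ])) (dec-false (x ≟ a) (ℕ.>⇒≢ a<x)))
         (∑ₗ-profile-singleton (suc a) r (λ u → ψ (0 ∷ u))))

[]%=suc≡eᵢ+ : ∀ {r} (d : Vec ℕ r) i → d [ i ]%= suc ≡ zipWith _+_ (replicate r 0 [ i ]%= suc) d
[]%=suc≡eᵢ+ (x ∷ d) zero    = cong (suc x ∷_) (sym (zipWith-identityˡ ℕ.+-identityˡ d))
[]%=suc≡eᵢ+ (x ∷ d) (suc i) = cong (x ∷_) ([]%=suc≡eᵢ+ d i)

-- A profile e with |e| = m is the profile of exactly multinomial e tuples of length m.
∑ₗ-tuples-profile : ∀ B a r m → m ≤ B → (φ : Vec ℕ r → ℚ) →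
  ∑ₗ (tuples (valuesFrom a r) m) (φ ∘ profile a r) ≡ ∑level B (replicate r 1) m (λ e → multinomial e ℚ.* φ e)
∑ₗ-tuples-profile B a r zero _ φ = begin
  φ (profile a r []) ℚ.+ 0ℚ                            ≡⟨ ℚ.+-identityʳ _ ⟩
  φ (profile a r [])                                   ≡⟨ cong φ (profile-[] a r) ⟩
  φ (replicate r 0)                                    ≡⟨ ℚ.*-identityˡ _ ⟨
  1ℚ ℚ.* φ (replicate r 0)                             ≡⟨ cong (ℚ._* φ (replicate r 0)) (multinomial-zeros r) ⟨
  multinomial (replicate r 0) ℚ.* φ (replicate r 0)    ≡⟨ ∑level-at-0 B (replicate r 1) (replicate-1≥1 r) _ ⟨
  ∑level B (replicate r 1) 0 (λ e → multinomial e ℚ.* φ e) ∎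
  where open ≡-Reasoning
∑ₗ-tuples-profile B a r (suc m) 1+m≤B φ = begin
  ∑ₗ (concatMap extend vs) (φ ∘ profile a r)
    ≡⟨ ∑ₗ-concatMap extend vs (φ ∘ profile a r) ⟩
  ∑ₗ vs (λ x → ∑ₗ (extend x) (φ ∘ profile a r))
    ≡⟨ ∑ₗ-cong vs (λ x → trans (∑ₗ-map (x ∷_) T (φ ∘ profile a r))
         (∑ₗ-cong T λ b → cong φ (profile-∷ a r x b))) ⟩
  ∑ₗ vs (λ x → ∑ₗ T (λ b → φ (zipWith _+_ (profile a r [ x ]) (profile a r b))))
    ≡⟨ ∑ₗ-cong vs (λ x → ∑ₗ-tuples-profile B a r m (ℕ.<⇒≤ 1+m≤B) (φ ∘ zipWith _+_ (profile a r [ x ]))) ⟩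
  ∑ₗ vs (λ x → shifted (profile a r [ x ]))
    ≡⟨ ∑ₗ-profile-singleton a r shifted ⟩
  ∑[ i < r ] shifted (replicate r 0 [ i ]%= suc)
    ≡⟨ sum-cong-≗ {r} (λ i → sym (pascal-term i)) ⟩
  ∑[ i < r ] pascal i
    ≡⟨ ∑level-multinomial B (replicate r 1) (replicate-1≥1 r) (suc m) (s≤s z≤n) 1+m≤B φ ⟨
  ∑level B (replicate r 1) (suc m) (λ e → multinomial e ℚ.* φ e) ∎
  where
  open ≡-Reasoning
  vs : List ℕ
  vs = valuesFrom a r
  T : List (Vec ℕ m)
  T = tuples vs m
  extend : ℕ → List (Vec ℕ (suc m))
  extend x = List.map (x ∷_) T
  shifted : Vec ℕ r → ℚ
  shifted u = ∑level B (replicate r 1) m (λ e → multinomial e ℚ.* φ (zipWith _+_ u e))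
  pascal : Fin r → ℚ
  pascal i = whenᵈ (lookup (replicate r 1) i ≤? suc m)
               (∑level B (replicate r 1) (suc m ∸ lookup (replicate r 1) i) (λ d → multinomial d ℚ.* φ (d [ i ]%= suc)))
  pascal-term : ∀ i → pascal i ≡ shifted (replicate r 0 [ i ]%= suc)
  pascal-term i = begin
    pascal i
      ≡⟨ cong (λ s → whenᵈ (s ≤? suc m) (∑level B (replicate r 1) (suc m ∸ s) (λ d → multinomial d ℚ.* φ (d [ i ]%= suc))))
              (lookup-replicate i 1) ⟩
    whenᵈ (1 ≤? suc m) (∑level B (replicate r 1) m (λ d → multinomial d ℚ.* φ (d [ i ]%= suc)))
      ≡⟨ whenᵈ-yes (1 ≤? suc m) (s≤s z≤n) _ ⟩
    ∑level B (replicate r 1) m (λ d → multinomial d ℚ.* φ (d [ i ]%= suc))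
      ≡⟨ ∑level-cong B (replicate r 1) m (λ d _ → cong (λ z → multinomial d ℚ.* φ z) ([]%=suc≡eᵢ+ d i)) ⟩
    shifted (replicate r 0 [ i ]%= suc) ∎

allZero : ∀ {r} → Vec ℕ r → Bool
allZero []          = true
allZero (zero  ∷ e) = allZero e
allZero (suc _ ∷ e) = false

-- validProfile S p e: e is the profile of consecutive values, the first p of which lie inside
-- the block before it.  Outside a block, an entry k > 0 must lie in S and opens a block of
-- k values (the other k − 1 absent), while an entry 0 ends the ranking.
validProfile : ∀ {j r} → Vec ℕ j → ℕ → Vec ℕ r → Bool
validProfile S p       []          = true
validProfile S (suc p) (zero  ∷ e) = validProfile S p e
validProfile S (suc p) (suc _ ∷ e) = false
validProfile S zero    (zero  ∷ e) = allZero e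
validProfile S zero    (suc k ∷ e) = does (suc k ∈? S) ∧ validProfile S k e

weight-ones : ∀ {r} (e : Vec ℕ r) → weight (replicate r 1) e ≡ Vec.sum e
weight-ones []      = refl
weight-ones (x ∷ e) = cong₂ _+_ (ℕ.*-identityˡ x) (weight-ones e)

∑level-ones : ∀ B r m (F : Vec ℕ (suc r) → ℚ) → ∑level B (replicate (suc r) 1) m F ≡
  ∑ℕ< (suc B) (λ x → whenᵈ (x ≤? m) (∑level B (replicate r 1) (m ∸ x) (F ∘ (x ∷_))))
∑level-ones B r m F = ∑ℕ<-cong (suc B) λ x →
  cong (λ z → whenᵈ (z ≤? m) (∑level B (replicate r 1) (m ∸ z) (F ∘ (x ∷_)))) (ℕ.*-identityˡ x)

∑level-allZero : ∀ {r} B (w : Vec ℕ r) → All (1 ≤_) w → ∀ m (F : Vec ℕ r → ℚ) →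
  ∑level B w m (λ e → when (allZero e) (F e)) ≡ whenᵈ (m ≟ 0) (F (replicate r 0))
∑level-allZero B []       _            m F = refl
∑level-allZero {suc r} B (w ∷ ws) (_ ∷ 1≤ws) m F = begin
  whenᵈ (w * 0 ≤? m) (below 0 (m ∸ w * 0)) ℚ.+ ∑ℕ< B (λ y → whenᵈ (w * suc y ≤? m) (below (suc y) (m ∸ w * suc y)))
    ≡⟨ cong₂ ℚ._+_ (cong (λ z → whenᵈ (z ≤? m) (below 0 (m ∸ z))) (ℕ.*-zeroʳ w))
                   (∑ℕ<-zero B λ y → trans (cong (whenᵈ (w * suc y ≤? m)) (∑level-0 B ws (m ∸ w * suc y)))
                                            (when-0 (does (w * suc y ≤? m)))) ⟩
  below 0 m ℚ.+ 0ℚ                           ≡⟨ ℚ.+-identityʳ _ ⟩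
  below 0 m                                  ≡⟨ ∑level-allZero B ws 1≤ws m (F ∘ (0 ∷_)) ⟩
  whenᵈ (m ≟ 0) (F (replicate (suc r) 0))    ∎
  where
  open ≡-Reasoning
  below : ℕ → ℕ → ℚ
  below x k = ∑level B ws k (λ e → when (allZero (x ∷ e)) (F (x ∷ e)))

∑ℕ<-point : ∀ N t (g : ℕ → ℚ) → ∑ℕ< N (λ k → when (does (k ≟ t)) (g k)) ≡ whenᵈ (t <? N) (g t)
∑ℕ<-point zero    t       g = sym (whenᵈ-no (t <? 0) (λ ()) (g t))
∑ℕ<-point (suc N) zero    g = trans (cong (g 0 ℚ.+_) (∑ℕ<-zero N λ _ → refl))
  (trans (ℚ.+-identityʳ (g 0)) (sym (whenᵈ-yes (0 <? suc N) (s≤s z≤n) _)))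
∑ℕ<-point (suc N) (suc t) g = trans (ℚ.+-identityˡ _)
  (trans (∑ℕ<-point N t (g ∘ suc)) (whenᵈ-⇔ (t <? N) (suc t <? suc N) s≤s ℕ.≤-pred (λ _ → refl)))

multinomial-0∷ : ∀ {r} (e : Vec ℕ r) → multinomial (0 ∷ e) ≡ multinomial e
multinomial-0∷ e = ℚ./-cong {p₁ = + (Vec.sum e !)} {{prodFact≢0 (0 ∷ e)}} {{prodFact≢0 e}}
  refl (ℕ.*-identityˡ (prodFact e))

multinomial-∷ : ∀ {r} x (e : Vec ℕ r) → multinomial (x ∷ e) ≡ ι ((x + Vec.sum e) C x) ℚ.* multinomial e
multinomial-∷ x e = begin
  multinomial (x ∷ e)                              ≡⟨ /≡ι*recip (N !) (x ! * P) {{prodFact≢0 (x ∷ e)}} ⟩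
  ι (N !) ℚ.* recip (x ! * P) {{prodFact≢0 (x ∷ e)}}
    ≡⟨ cong₂ ℚ._*_ (cong ι (sym N!≡)) (recip-* (x !) P {{x !≢0}} {{prodFact≢0 e}}) ⟩
  ι (x ! * (Vec.sum e) ! * (N C x)) ℚ.* (X⁻¹ ℚ.* P⁻¹)
    ≡⟨ cong (ℚ._* (X⁻¹ ℚ.* P⁻¹)) (trans (ι-* (x ! * (Vec.sum e) !) (N C x)) (cong (ℚ._* ι (N C x)) (ι-* (x !) (Vec.sum e !)))) ⟩
  ι (x !) ℚ.* ι (Vec.sum e !) ℚ.* ι (N C x) ℚ.* (X⁻¹ ℚ.* P⁻¹)
    ≡⟨ solve 5 (λ a b c ia ip → a :* b :* c :* (ia :* ip) := (a :* ia) :* (c :* (b :* ip))) refl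
               (ι (x !)) (ι (Vec.sum e !)) (ι (N C x)) X⁻¹ P⁻¹ ⟩
  (ι (x !) ℚ.* X⁻¹) ℚ.* (ι (N C x) ℚ.* (ι (Vec.sum e !) ℚ.* P⁻¹))
    ≡⟨ cong (ℚ._* (ι (N C x) ℚ.* (ι (Vec.sum e !) ℚ.* P⁻¹))) (ι*recip≡1 (x !) {{x !≢0}}) ⟩
  1ℚ ℚ.* (ι (N C x) ℚ.* (ι (Vec.sum e !) ℚ.* P⁻¹))  ≡⟨ ℚ.*-identityˡ _ ⟩
  ι (N C x) ℚ.* (ι (Vec.sum e !) ℚ.* P⁻¹)
    ≡⟨ cong (ι (N C x) ℚ.*_) (/≡ι*recip (Vec.sum e !) P {{prodFact≢0 e}}) ⟨
  ι (N C x) ℚ.* multinomial e                      ∎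
  where
  open ≡-Reasoning
  open +-*-Solver
  N P : ℕ
  N = x + Vec.sum e
  P = prodFact e
  X⁻¹ P⁻¹ : ℚ
  X⁻¹ = recip (x !) {{x !≢0}}
  P⁻¹ = recip P {{prodFact≢0 e}}
  instance _ = ℕ.m*n≢0 (x !) ((N ∸ x) !) {{x !≢0}} {{(N ∸ x) !≢0}}
  N!≡ : x ! * (Vec.sum e) ! * (N C x) ≡ N !
  N!≡ = begin
    x ! * (Vec.sum e) ! * (N C x)   ≡⟨ cong (λ z → x ! * z ! * (N C x)) (ℕ.m+n∸m≡n x (Vec.sum e)) ⟨
    x ! * (N ∸ x) ! * (N C x)       ≡⟨ cong (x ! * (N ∸ x) ! *_) (nCk≡n!/k![n-k]! (ℕ.m≤m+n x (Vec.sum e))) ⟩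
    x ! * (N ∸ x) ! * _             ≡⟨ m*[n/m]≡n (k![n∸k]!∣n! (ℕ.m≤m+n x (Vec.sum e))) ⟩
    N !                             ∎

∑ℕ<-∈ : ∀ {j} (S : Vec ℕ j) → All (1 ≤_) S → Unique S → ∀ B m → m ≤ B → (f : ℕ → ℚ) →
  ∑ℕ< B (λ k → whenᵈ (suc k ≤? m) (when (does (suc k ∈? S)) (f (suc k)))) ≡
  ∑[ i < j ] whenᵈ (lookup S i ≤? m) (f (lookup S i))
∑ℕ<-∈ []      _            _                 B m m≤B f = ∑ℕ<-zero B λ k → when-0 (does (suc k ≤? m))
∑ℕ<-∈ (s ∷ S) (1≤s ∷ 1≤S) (s∉S ∷ S-unique) B m m≤B f = begin
  ∑ℕ< B (λ k → guarded k (when (does (suc k ∈? s ∷ S)) (f (suc k))))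
    ≡⟨ ∑ℕ<-cong B (λ k → trans
         (cong (guarded k) (when-∨ (does (suc k ≟ s)) (does (suc k ∈? S)) (f (suc k)) (excl (suc k))))
         (when-+ (does (suc k ≤? m)) (isS k) (inS k))) ⟩
  ∑ℕ< B (λ k → guarded k (isS k) ℚ.+ guarded k (inS k))
    ≡⟨ ∑-distrib-+ {B} (λ k → guarded (toℕ k) (isS (toℕ k))) (λ k → guarded (toℕ k) (inS (toℕ k))) ⟩
  ∑ℕ< B (λ k → guarded k (isS k)) ℚ.+ ∑ℕ< B (λ k → guarded k (inS k))
    ≡⟨ cong₂ ℚ._+_ (only-s s 1≤s) (∑ℕ<-∈ S 1≤S S-unique B m m≤B f) ⟩
  whenᵈ (s ≤? m) (f s) ℚ.+ ∑[ i < _ ] whenᵈ (lookup S i ≤? m) (f (lookup S i)) ∎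
  where
  open ≡-Reasoning
  guarded : ℕ → ℚ → ℚ
  guarded k = whenᵈ (suc k ≤? m)
  isS inS : ℕ → ℚ
  isS k = when (does (suc k ≟ s)) (f (suc k))
  inS k = when (does (suc k ∈? S)) (f (suc k))
  excl : ∀ y → does (y ≟ s) ≡ true → does (y ∈? S) ≡ false
  excl y y≟s = dec-false (y ∈? S) λ y∈S →
    let (s≢z , y≡z) = All.lookupAny s∉S y∈S in s≢z (trans (sym (does≡true⇒ (y ≟ s) y≟s)) y≡z)
  only-s : ∀ s → 1 ≤ s → ∑ℕ< B (λ k → guarded k (when (does (suc k ≟ s)) (f (suc k)))) ≡ whenᵈ (s ≤? m) (f s)
  only-s (suc t) _ = begin
    ∑ℕ< B (λ k → guarded k (when (does (k ≟ t)) (f (suc k))))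
      ≡⟨ ∑ℕ<-cong B (λ k → when-comm (does (suc k ≤? m)) (does (k ≟ t)) (f (suc k))) ⟩
    ∑ℕ< B (λ k → when (does (k ≟ t)) (guarded k (f (suc k))))
      ≡⟨ ∑ℕ<-point B t (λ k → guarded k (f (suc k))) ⟩
    whenᵈ (t <? B) (guarded t (f (suc t)))
      ≡⟨ whenᵈ-× (t <? B) (suc t ≤? m) (suc t ≤? m) (λ _ 1+t≤m → 1+t≤m) (λ 1+t≤m → ℕ.≤-trans 1+t≤m m≤B) id (λ _ _ → refl) ⟩
    whenᵈ (suc t ≤? m) (f (suc t)) ∎

∑validProfiles : ∀ {j} → Vec ℕ j → ℕ → ℕ → ℕ → ℕ → ℚ
∑validProfiles S B r p m = ∑level B (replicate r 1) m (λ e → when (validProfile S p e) (multinomial e))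

module _ {j} (S : Vec ℕ j) (1≤S : All (1 ≤_) S) (S-unique : Unique S) where

  -- By splitting off the first block, exactly as orderedPartitions is defined.
  ∑validProfiles≡orderedPartitions : ∀ B r p m → p + m ≤ r → m ≤ B → ∑validProfiles S B r p m ≡ orderedPartitions S m
  ∑validProfiles≡orderedPartitions B zero    zero    zero _ _ = refl
  ∑validProfiles≡orderedPartitions B (suc r) (suc p) m p+m≤r m≤B = begin
    ∑validProfiles S B (suc r) (suc p) m
      ≡⟨ ∑level-ones B r m (λ e → when (validProfile S (suc p) e) (multinomial e)) ⟩
    term 0 ℚ.+ ∑ℕ< B (term ∘ suc)
      ≡⟨ cong₂ ℚ._+_ term-0 (∑ℕ<-zero B term-suc) ⟩
    orderedPartitions S m ℚ.+ 0ℚ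
      ≡⟨ ℚ.+-identityʳ _ ⟩
    orderedPartitions S m                  ∎
    where
    open ≡-Reasoning
    term : ℕ → ℚ
    term x = whenᵈ (x ≤? m) (∑level B (replicate r 1) (m ∸ x)
               (λ e → when (validProfile S (suc p) (x ∷ e)) (multinomial (x ∷ e))))
    term-0 : term 0 ≡ orderedPartitions S m
    term-0 = trans (∑level-cong B (replicate r 1) m λ e _ → cong (when (validProfile S p e)) (multinomial-0∷ e))
                   (∑validProfiles≡orderedPartitions B r p m (ℕ.≤-pred p+m≤r) m≤B)
    term-suc : ∀ y → term (suc y) ≡ 0ℚ
    term-suc y = trans (cong (whenᵈ (suc y ≤? m)) (∑level-0 B (replicate r 1) (m ∸ suc y)))
                       (when-0 (does (suc y ≤? m)))
  ∑validProfiles≡orderedPartitions B (suc r) zero m m≤1+r m≤B = begin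
    ∑validProfiles S B (suc r) zero m
      ≡⟨ ∑level-ones B r m (λ e → when (validProfile S zero e) (multinomial e)) ⟩
    term 0 ℚ.+ ∑ℕ< B (term ∘ suc)
      ≡⟨ cong₂ ℚ._+_ term-0 (∑ℕ<-cong B term-suc) ⟩
    whenᵈ (m ≟ 0) 1ℚ ℚ.+ ∑ℕ< B (λ k → whenᵈ (suc k ≤? m) (when (does (suc k ∈? S)) (f (suc k))))
      ≡⟨ cong (whenᵈ (m ≟ 0) 1ℚ ℚ.+_) (∑ℕ<-∈ S 1≤S S-unique B m m≤B f) ⟩
    whenᵈ (m ≟ 0) 1ℚ ℚ.+ ∑[ i < j ] whenᵈ (lookup S i ≤? m) (f (lookup S i))
      ≡⟨ orderedPartitions-unfold S 1≤S m ⟩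
    orderedPartitions S m ∎
    where
    open ≡-Reasoning
    f : ℕ → ℚ
    f k = ι (m C k) ℚ.* orderedPartitions S (m ∸ k)
    term : ℕ → ℚ
    term x = whenᵈ (x ≤? m) (∑level B (replicate r 1) (m ∸ x)
               (λ e → when (validProfile S zero (x ∷ e)) (multinomial (x ∷ e))))
    term-0 : term 0 ≡ whenᵈ (m ≟ 0) 1ℚ
    term-0 = trans (∑level-allZero B (replicate r 1) (replicate-1≥1 r) m (multinomial ∘ (0 ∷_)))
                   (cong (whenᵈ (m ≟ 0)) (multinomial-zeros (suc r)))
    term-suc : ∀ k → term (suc k) ≡ whenᵈ (suc k ≤? m) (when (does (suc k ∈? S)) (f (suc k)))
    term-suc k = whenᵈ-cong (suc k ≤? m) λ 1+k≤m → begin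
      ∑level B (replicate r 1) (m ∸ suc k) (λ e → when (k∈S ∧ validProfile S k e) (multinomial (suc k ∷ e)))
        ≡⟨ ∑level-cong B (replicate r 1) (m ∸ suc k) (λ e we → factor e (trans (sym (weight-ones e)) we) 1+k≤m) ⟩
      ∑level B (replicate r 1) (m ∸ suc k) (λ e → when k∈S 1ℚ ℚ.* (ι (m C suc k) ℚ.* when (validProfile S k e) (multinomial e)))
        ≡⟨ ∑level-* B (replicate r 1) (m ∸ suc k) (when k∈S 1ℚ) _ ⟩
      when k∈S 1ℚ ℚ.* ∑level B (replicate r 1) (m ∸ suc k) (λ e → ι (m C suc k) ℚ.* when (validProfile S k e) (multinomial e))
        ≡⟨ cong (when k∈S 1ℚ ℚ.*_) (∑level-* B (replicate r 1) (m ∸ suc k) (ι (m C suc k)) _) ⟩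
      when k∈S 1ℚ ℚ.* (ι (m C suc k) ℚ.* ∑validProfiles S B r k (m ∸ suc k))
        ≡⟨ cong (λ z → when k∈S 1ℚ ℚ.* (ι (m C suc k) ℚ.* z))
             (∑validProfiles≡orderedPartitions B r k (m ∸ suc k) (bound 1+k≤m) (ℕ.≤-trans (ℕ.m∸n≤m m (suc k)) m≤B)) ⟩
      when k∈S 1ℚ ℚ.* f (suc k)
        ≡⟨ when-1* k∈S (f (suc k)) ⟩
      when k∈S (f (suc k)) ∎
      where
      k∈S : Bool
      k∈S = does (suc k ∈? S)
      bound : suc k ≤ m → k + (m ∸ suc k) ≤ r
      bound 1+k≤m = ℕ.≤-pred (subst (_≤ suc r) (sym (ℕ.m+[n∸m]≡n 1+k≤m)) m≤1+r)
      factor : ∀ e → Vec.sum e ≡ m ∸ suc k → suc k ≤ m →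
        when (k∈S ∧ validProfile S k e) (multinomial (suc k ∷ e)) ≡
        when k∈S 1ℚ ℚ.* (ι (m C suc k) ℚ.* when (validProfile S k e) (multinomial e))
      factor e |e|≡ 1+k≤m = begin
        when (k∈S ∧ validProfile S k e) (multinomial (suc k ∷ e))
          ≡⟨ when-∧ k∈S (validProfile S k e) _ ⟩
        when k∈S 1ℚ ℚ.* when (validProfile S k e) (multinomial (suc k ∷ e))
          ≡⟨ cong (λ z → when k∈S 1ℚ ℚ.* when (validProfile S k e) z) (multinomial-∷ (suc k) e) ⟩
        when k∈S 1ℚ ℚ.* when (validProfile S k e) (ι ((suc k + Vec.sum e) C suc k) ℚ.* multinomial e)
          ≡⟨ cong (λ z → when k∈S 1ℚ ℚ.* when (validProfile S k e) (ι (z C suc k) ℚ.* multinomial e))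
               (trans (cong (_+_ (suc k)) |e|≡) (ℕ.m+[n∸m]≡n 1+k≤m)) ⟩
        when k∈S 1ℚ ℚ.* when (validProfile S k e) (ι (m C suc k) ℚ.* multinomial e)
          ≡⟨ cong (when k∈S 1ℚ ℚ.*_) (when-* (validProfile S k e) (ι (m C suc k)) (multinomial e)) ⟩
        when k∈S 1ℚ ℚ.* (ι (m C suc k) ℚ.* when (validProfile S k e) (multinomial e)) ∎

occ-∷-≡ : ∀ {k} x v (b : Vec ℕ k) → x ≡ v → occ v (x ∷ b) ≡ suc (occ v b)
occ-∷-≡ x v b x≡v = cong (λ t → (if t then suc else id) (occ v b)) (dec-true (x ≟ v) x≡v)

occ-∷-≢ : ∀ {k} x v (b : Vec ℕ k) → ¬ x ≡ v → occ v (x ∷ b) ≡ occ v b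
occ-∷-≢ x v b x≢v = cong (λ t → (if t then suc else id) (occ v b)) (dec-false (x ≟ v) x≢v)

occ-∷-≤ : ∀ {k} x v (b : Vec ℕ k) → occ v b ≤ occ v (x ∷ b)
occ-∷-≤ x v b with x ≟ v
... | yes x≡v = subst (occ v b ≤_) (sym (occ-∷-≡ x v b x≡v)) (ℕ.n≤1+n _)
... | no  x≢v = ℕ.≤-reflexive (sym (occ-∷-≢ x v b x≢v))

occ-head>0 : ∀ {k} x (b : Vec ℕ k) → 0 < occ x (x ∷ b)
occ-head>0 x b = subst (0 <_) (sym (occ-∷-≡ x x b refl)) (s≤s z≤n)

occ>0⇒∈ : ∀ {k} v (b : Vec ℕ k) → 0 < occ v b → Any (_≡ v) b
occ>0⇒∈ v (x ∷ b) pos with x ≟ v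
... | yes x≡v = here x≡v
... | no  x≢v = there (occ>0⇒∈ v b (subst (0 <_) (occ-∷-≢ x v b x≢v) pos))

∈⇒occ>0 : ∀ {k} v (b : Vec ℕ k) → Any (_≡ v) b → 0 < occ v b
∈⇒occ>0 v (x ∷ b) (here x≡v) = subst (0 <_) (sym (occ-∷-≡ x v b x≡v)) (s≤s z≤n)
∈⇒occ>0 v (x ∷ b) (there v∈b) = ℕ.<-≤-trans (∈⇒occ>0 v b v∈b) (occ-∷-≤ x v b)

All⇒occ>0⇒ : ∀ {k} {P : ℕ → Set} (b : Vec ℕ k) → All P b → ∀ v → 0 < occ v b → P v
All⇒occ>0⇒ {P = P} b all v pos = let (pz , z≡v) = All.lookupAny all (occ>0⇒∈ v b pos) in subst P z≡v pz

occ>0⇒⇒All : ∀ {k} {P : ℕ → Set} (b : Vec ℕ k) → (∀ v → 0 < occ v b → P v) → All P b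
occ>0⇒⇒All []      h = []
occ>0⇒⇒All (x ∷ b) h = h x (occ-head>0 x b) ∷ occ>0⇒⇒All b (λ v pos → h v (ℕ.<-≤-trans pos (occ-∷-≤ x v b)))

Any⇒occ>0 : ∀ {k} {P : ℕ → Set} (b : Vec ℕ k) → Any P b → Σ ℕ (λ v → 0 < occ v b × P v)
Any⇒occ>0 (x ∷ b) (here px)  = x , occ-head>0 x b , px
Any⇒occ>0 (x ∷ b) (there pb) with Any⇒occ>0 b pb
... | v , pos , pv = v , ℕ.<-≤-trans pos (occ-∷-≤ x v b) , pv

occ>0⇒Any : ∀ {k} {P : ℕ → Set} (b : Vec ℕ k) v → 0 < occ v b → P v → Any P b
occ>0⇒Any b v pos pv = Any.map (λ { refl → pv }) (occ>0⇒∈ v b pos)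

module _ {j k} (S : Vec ℕ j) (b : Vec ℕ k) (N : ℕ) (occ-bounded : ∀ v → N < v → occ v b ≡ 0) where

  VanishesFrom : ℕ → Set
  VanishesFrom a = ∀ v → a ≤ v → occ v b ≡ 0

  BlockAt : ℕ → Set
  BlockAt x = (occ x b ∈ S)
            × (∀ y → x < y → y < x + occ x b → occ y b ≡ 0)
            × (∀ y → x < y → 0 < occ y b → 0 < occ (x + occ x b) b)

  -- The values from a on satisfy the block conditions, the first p of them lying inside the
  -- block of a smaller value.
  record Valid (a p : ℕ) : Set where
    field
      gap    : ∀ v → a ≤ v → v < a + p → occ v b ≡ 0
      next   : 0 < occ (a + p) b ⊎ VanishesFrom (a + p)
      blocks : ∀ x → a ≤ x → 0 < occ x b → BlockAt x

  vanishesFrom-∷ : ∀ a → occ a b ≡ 0 → VanishesFrom (suc a) → VanishesFrom a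
  vanishesFrom-∷ a occ-a≡0 van v a≤v with ℕ.m≤n⇒m<n∨m≡n a≤v
  ... | inj₁ a<v  = van v a<v
  ... | inj₂ refl = occ-a≡0

  vanishesFrom⇒Valid : ∀ a p → VanishesFrom a → Valid a p
  vanishesFrom⇒Valid a p van = record
    { gap    = λ v a≤v _ → van v a≤v
    ; next   = inj₂ λ v a+p≤v → van v (ℕ.≤-trans (ℕ.m≤m+n a p) a+p≤v)
    ; blocks = λ x a≤x pos → ⊥-elim (ℕ.<-irrefl (sym (van x a≤x)) pos)
    }

  Valid⇒vanishesFrom : ∀ a → occ a b ≡ 0 → Valid a 0 → VanishesFrom a
  Valid⇒vanishesFrom a occ-a≡0 V with Valid.next V
  ... | inj₁ pos = ⊥-elim (ℕ.<-irrefl (sym (trans (cong (λ z → occ z b) (ℕ.+-identityʳ a)) occ-a≡0)) pos)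
  ... | inj₂ van = λ v a≤v → van v (subst (_≤ v) (sym (ℕ.+-identityʳ a)) a≤v)

  Valid-gap⇒ : ∀ a p → occ a b ≡ 0 → Valid (suc a) p → Valid a (suc p)
  Valid-gap⇒ a p occ-a≡0 V = record
    { gap    = gap
    ; next   = subst (λ z → 0 < occ z b ⊎ VanishesFrom z) (sym (ℕ.+-suc a p)) (Valid.next V)
    ; blocks = blocks
    }
    where
    gap : ∀ v → a ≤ v → v < a + suc p → occ v b ≡ 0
    gap v a≤v v<a+1+p with ℕ.m≤n⇒m<n∨m≡n a≤v
    ... | inj₁ a<v  = Valid.gap V v a<v (subst (v <_) (ℕ.+-suc a p) v<a+1+p)
    ... | inj₂ refl = occ-a≡0
    blocks : ∀ x → a ≤ x → 0 < occ x b → BlockAt x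
    blocks x a≤x pos with ℕ.m≤n⇒m<n∨m≡n a≤x
    ... | inj₁ a<x  = Valid.blocks V x a<x pos
    ... | inj₂ refl = ⊥-elim (ℕ.<-irrefl (sym occ-a≡0) pos)

  Valid-gap⇐ : ∀ a p → Valid a (suc p) → Valid (suc a) p
  Valid-gap⇐ a p V = record
    { gap    = λ v a<v v<1+a+p → Valid.gap V v (ℕ.<⇒≤ a<v) (subst (v <_) (sym (ℕ.+-suc a p)) v<1+a+p)
    ; next   = subst (λ z → 0 < occ z b ⊎ VanishesFrom z) (ℕ.+-suc a p) (Valid.next V)
    ; blocks = λ x a<x → Valid.blocks V x (ℕ.<⇒≤ a<x)
    }

  Valid-block⇒ : ∀ a k → occ a b ≡ suc k → suc k ∈ S → Valid (suc a) k → Valid a 0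
  Valid-block⇒ a k occ-a≡1+k 1+k∈S V = record
    { gap    = λ v a≤v v<a+0 → ⊥-elim (ℕ.<-irrefl refl (ℕ.<-≤-trans v<a+0 (subst (_≤ v) (sym (ℕ.+-identityʳ a)) a≤v)))
    ; next   = inj₁ (subst (λ z → 0 < occ z b) (sym (ℕ.+-identityʳ a)) (subst (0 <_) (sym occ-a≡1+k) (s≤s z≤n)))
    ; blocks = blocks
    }
    where
    end≡ : a + occ a b ≡ suc a + k
    end≡ = trans (cong (_+_ a) occ-a≡1+k) (ℕ.+-suc a k)
    block : BlockAt a
    block = subst (_∈ S) (sym occ-a≡1+k) 1+k∈S
          , (λ y a<y y<end → Valid.gap V y a<y (subst (y <_) end≡ y<end))
          , next-occurs
      where
      next-occurs : ∀ y → a < y → 0 < occ y b → 0 < occ (a + occ a b) b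
      next-occurs y a<y pos with Valid.next V
      ... | inj₁ pos′ = subst (λ z → 0 < occ z b) (sym end≡) pos′
      ... | inj₂ van with y <? suc a + k
      ...   | yes y<end = ⊥-elim (ℕ.<-irrefl (sym (Valid.gap V y a<y y<end)) pos)
      ...   | no  y≮end = ⊥-elim (ℕ.<-irrefl (sym (van y (ℕ.≮⇒≥ y≮end))) pos)
    blocks : ∀ x → a ≤ x → 0 < occ x b → BlockAt x
    blocks x a≤x pos with ℕ.m≤n⇒m<n∨m≡n a≤x
    ... | inj₁ a<x  = Valid.blocks V x a<x pos
    ... | inj₂ refl = block

  Valid-block⇐ : ∀ a k → occ a b ≡ suc k → Valid a 0 → suc k ∈ S × Valid (suc a) k
  Valid-block⇐ a k occ-a≡1+k V = subst (_∈ S) occ-a≡1+k in-S , record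
    { gap    = λ v a<v v<1+a+k → inside v a<v (subst (v <_) (sym end≡) v<1+a+k)
    ; next   = next
    ; blocks = λ x a<x → Valid.blocks V x (ℕ.<⇒≤ a<x)
    }
    where
    block : BlockAt a
    block = Valid.blocks V a ℕ.≤-refl (subst (0 <_) (sym occ-a≡1+k) (s≤s z≤n))
    in-S : occ a b ∈ S
    in-S = proj₁ block
    inside : ∀ y → a < y → y < a + occ a b → occ y b ≡ 0
    inside = proj₁ (proj₂ block)
    onward : ∀ y → a < y → 0 < occ y b → 0 < occ (a + occ a b) b
    onward = proj₂ (proj₂ block)
    end≡ : a + occ a b ≡ suc a + k
    end≡ = trans (cong (_+_ a) occ-a≡1+k) (ℕ.+-suc a k)
    next : 0 < occ (suc a + k) b ⊎ VanishesFrom (suc a + k)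
    next with 0 <? occ (suc a + k) b
    ... | yes pos = inj₁ pos
    ... | no  ¬pos = inj₂ vanish
      where
      vanish : VanishesFrom (suc a + k)
      vanish v end≤v with occ v b in occ-v
      ... | zero  = refl
      ... | suc _ = ⊥-elim (¬pos (subst (λ z → 0 < occ z b) end≡
                      (onward v (ℕ.<-≤-trans (ℕ.n<1+n a) (ℕ.≤-trans (ℕ.m≤m+n (suc a) k) end≤v))
                                (subst (0 <_) (sym occ-v) (s≤s z≤n)))))

  vanishesFrom-1+N : ∀ a → a + 0 ≡ suc N → VanishesFrom a
  vanishesFrom-1+N a a+0≡1+N v a≤v = occ-bounded v (subst (_≤ v) (trans (sym (ℕ.+-identityʳ a)) a+0≡1+N) a≤v)

  allZero-profile⇒ : ∀ r a → a + r ≡ suc N → allZero (profile a r b) ≡ true → VanishesFrom a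
  allZero-profile⇒ zero    a a+0≡1+N _ = vanishesFrom-1+N a a+0≡1+N
  allZero-profile⇒ (suc r) a a+1+r≡ h with occ a b in occ-a
  ... | zero = vanishesFrom-∷ a occ-a (allZero-profile⇒ r (suc a) (trans (sym (ℕ.+-suc a r)) a+1+r≡) h)

  allZero-profile⇐ : ∀ r a → VanishesFrom a → allZero (profile a r b) ≡ true
  allZero-profile⇐ zero    a van = refl
  allZero-profile⇐ (suc r) a van with occ a b in occ-a
  ... | zero  = allZero-profile⇐ r (suc a) (λ v a<v → van v (ℕ.<⇒≤ a<v))
  ... | suc _ = ⊥-elim (ℕ.1+n≢0 (trans (sym occ-a) (van a ℕ.≤-refl)))

  validProfile-sound : ∀ r a p → a + r ≡ suc N → validProfile S p (profile a r b) ≡ true → Valid a p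
  validProfile-sound zero a p a+0≡1+N _ = vanishesFrom⇒Valid a p (vanishesFrom-1+N a a+0≡1+N)
  validProfile-sound (suc r) a (suc p) a+1+r≡ h with occ a b in occ-a
  ... | zero = Valid-gap⇒ a p occ-a (validProfile-sound r (suc a) p (trans (sym (ℕ.+-suc a r)) a+1+r≡) h)
  validProfile-sound (suc r) a zero a+1+r≡ h with occ a b in occ-a
  ... | zero  = vanishesFrom⇒Valid a 0
                  (vanishesFrom-∷ a occ-a (allZero-profile⇒ r (suc a) (trans (sym (ℕ.+-suc a r)) a+1+r≡) h))
  ... | suc k = Valid-block⇒ a k occ-a (does≡true⇒ (suc k ∈? S) (proj₁ (∧≡true⇒ h)))
                  (validProfile-sound r (suc a) k (trans (sym (ℕ.+-suc a r)) a+1+r≡) (proj₂ (∧≡true⇒ h)))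

  validProfile-complete : ∀ r a p → Valid a p → validProfile S p (profile a r b) ≡ true
  validProfile-complete zero    a p V = refl
  validProfile-complete (suc r) a (suc p) V with occ a b in occ-a
  ... | zero  = validProfile-complete r (suc a) p (Valid-gap⇐ a p V)
  ... | suc _ = ⊥-elim (ℕ.1+n≢0 (trans (sym occ-a) (Valid.gap V a ℕ.≤-refl (ℕ.m<m+n a (s≤s z≤n)))))
  validProfile-complete (suc r) a zero V with occ a b in occ-a
  ... | zero  = allZero-profile⇐ r (suc a) λ v a<v → Valid⇒vanishesFrom a occ-a V v (ℕ.<⇒≤ a<v)
  ... | suc k = cong₂ _∧_ (dec-true (suc k ∈? S) (proj₁ (Valid-block⇐ a k occ-a V)))
                          (validProfile-complete r (suc a) k (proj₂ (Valid-block⇐ a k occ-a V)))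

module _ {j} (S : Vec ℕ j) (n : ℕ) (b : Vec ℕ (suc n)) (b∈[1,1+n] : All (λ x → 1 ≤ x × x ≤ suc n) b) where

  occ-bounded : ∀ v → suc n < v → occ v b ≡ 0
  occ-bounded v 1+n<v = ℕ.n≤0⇒n≡0 (ℕ.≮⇒≥ λ pos →
    ℕ.<⇒≱ 1+n<v (proj₂ (All⇒occ>0⇒ b b∈[1,1+n] v pos)))

  IsFR-T2⇒Valid : IsFR-T2 (suc n) S b → Valid S b (suc n) occ-bounded 1 0
  IsFR-T2⇒Valid ((_ , has-1 , nexts) , in-S) = record
    { gap    = λ v 1≤v v<1 → ⊥-elim (ℕ.<-irrefl refl (ℕ.<-≤-trans v<1 1≤v))
    ; next   = inj₁ (∈⇒occ>0 1 b has-1)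
    ; blocks = λ x _ pos → All⇒occ>0⇒ b in-S x pos , inside x pos , onward x pos
    }
    where
    inside : ∀ x → 0 < occ x b → ∀ y → x < y → y < x + occ x b → occ y b ≡ 0
    inside x pos y x<y y<end = ℕ.n≤0⇒n≡0 (ℕ.≮⇒≥ λ posy →
      ℕ.<⇒≱ y<end (All⇒occ>0⇒ b (proj₁ (All⇒occ>0⇒ b nexts x pos)) y posy x<y))
    onward : ∀ x → 0 < occ x b → ∀ y → x < y → 0 < occ y b → 0 < occ (x + occ x b) b
    onward x pos y x<y posy = ∈⇒occ>0 (x + occ x b) b (proj₂ (All⇒occ>0⇒ b nexts x pos) (occ>0⇒Any b y posy x<y))

  Valid⇒IsFR-T2 : Valid S b (suc n) occ-bounded 1 0 → IsFR-T2 (suc n) S b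
  Valid⇒IsFR-T2 V = (b∈[1,1+n] , has-1 , occ>0⇒⇒All b λ x pos → occ>0⇒⇒All b (least x pos) , next x pos)
                  , occ>0⇒⇒All b (λ x pos → proj₁ (block x pos))
    where
    block : ∀ x → 0 < occ x b → BlockAt S b (suc n) occ-bounded x
    block x pos = Valid.blocks V x (proj₁ (All⇒occ>0⇒ b b∈[1,1+n] x pos)) pos
    has-1 : Any (_≡ 1) b
    has-1 with Valid.next V
    ... | inj₁ pos = occ>0⇒∈ 1 b pos
    ... | inj₂ van = ⊥-elim (some-value-occurs b b∈[1,1+n] van)
      where
      some-value-occurs : ∀ {k} (c : Vec ℕ (suc k)) → All (λ x → 1 ≤ x × x ≤ suc n) c →
                          ¬ (∀ v → 1 ≤ v → occ v c ≡ 0)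
      some-value-occurs (x ∷ c) ((1≤x , _) ∷ _) van = ℕ.<-irrefl (sym (van x 1≤x)) (occ-head>0 x c)
    least : ∀ x → 0 < occ x b → ∀ y → 0 < occ y b → x < y → x + occ x b ≤ y
    least x pos y posy x<y with y <? x + occ x b
    ... | yes y<end = ⊥-elim (ℕ.<-irrefl (sym (proj₁ (proj₂ (block x pos)) y x<y y<end)) posy)
    ... | no  y≮end = ℕ.≮⇒≥ y≮end
    next : ∀ x → 0 < occ x b → Any (x <_) b → Any (_≡ x + occ x b) b
    next x pos x<b with Any⇒occ>0 b x<b
    ... | y , posy , x<y = occ>0⇒∈ (x + occ x b) b (proj₂ (proj₂ (block x pos)) y x<y posy)

  isFR-T2?≡validProfile : does (isFR-T2? (suc n) S b) ≡ validProfile S 0 (profile 1 (suc n) b)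
  isFR-T2?≡validProfile = does≡-⇔ (isFR-T2? (suc n) S b) _
    (validProfile-complete S b (suc n) occ-bounded (suc n) 1 0 ∘ IsFR-T2⇒Valid)
    (Valid⇒IsFR-T2 ∘ validProfile-sound S b (suc n) occ-bounded (suc n) 1 0 refl)

range1≡valuesFrom : ∀ n → range1 n ≡ valuesFrom 1 n
range1≡valuesFrom n = shift id 0 n (λ _ → refl)
  where
  shift : ∀ (g : ℕ → ℕ) a n → (∀ i → g i ≡ a + i) → List.map suc (applyUpTo g n) ≡ valuesFrom (suc a) n
  shift g a zero    eq = refl
  shift g a (suc n) eq = cong₂ _∷_ (cong suc (trans (eq 0) (ℕ.+-identityʳ a)))
                                   (shift (g ∘ suc) (suc a) n (λ i → trans (eq (suc i)) (ℕ.+-suc a i)))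

valuesFrom-bounds : ∀ a r → ListAll.All (λ x → a ≤ x × x < a + r) (valuesFrom a r)
valuesFrom-bounds a zero    = ListAll.[]
valuesFrom-bounds a (suc r) = (ℕ.≤-refl , ℕ.m<m+n a (s≤s z≤n)) ListAll.∷
  ListAll.map (λ {x} (a<x , x<1+a+r) → ℕ.<⇒≤ a<x , subst (x <_) (sym (ℕ.+-suc a r)) x<1+a+r)
              (valuesFrom-bounds (suc a) r)

ι-numFR-T2≡∑validProfiles : ∀ {j} (S : Vec ℕ j) n → ι (numFR-T2 (suc n) S) ≡ ∑validProfiles S (suc n) (suc n) 0 (suc n)
ι-numFR-T2≡∑validProfiles S n = begin
  ι (numFR-T2 N S)
    ≡⟨ ι-length-filter (isFR-T2? N S) (tuples (range1 N) N) ⟩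
  ∑ₗ (tuples (range1 N) N) (λ b → whenᵈ (isFR-T2? N S b) 1ℚ)
    ≡⟨ cong (λ vs → ∑ₗ (tuples vs N) (λ b → whenᵈ (isFR-T2? N S b) 1ℚ)) (range1≡valuesFrom N) ⟩
  ∑ₗ (tuples (valuesFrom 1 N) N) (λ b → whenᵈ (isFR-T2? N S b) 1ℚ)
    ≡⟨ ∑ₗ-tuples-cong (valuesFrom 1 N) (valuesFrom-bounds 1 N) N (λ b b∈ →
         cong (λ t → when t 1ℚ) (isFR-T2?≡validProfile S n b (All.map in-range b∈))) ⟩
  ∑ₗ (tuples (valuesFrom 1 N) N) (λ b → when (validProfile S 0 (profile 1 N b)) 1ℚ)
    ≡⟨ ∑ₗ-tuples-profile N 1 N N ℕ.≤-refl (λ e → when (validProfile S 0 e) 1ℚ) ⟩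
  ∑level N (replicate N 1) N (λ e → multinomial e ℚ.* when (validProfile S 0 e) 1ℚ)
    ≡⟨ ∑level-cong N (replicate N 1) N (λ e _ → *-when-1 (validProfile S 0 e) (multinomial e)) ⟩
  ∑validProfiles S N N 0 N ∎
  where
  open ≡-Reasoning
  N : ℕ
  N = suc n
  *-when-1 : ∀ t x → x ℚ.* when t 1ℚ ≡ when t x
  *-when-1 t x = trans (ℚ.*-comm x (when t 1ℚ)) (when-1* t x)
  in-range : ∀ {x} → 1 ≤ x × x < 1 + N → 1 ≤ x × x ≤ N
  in-range (1≤x , x<1+N) = 1≤x , ℕ.≤-pred x<1+N

theorem4p4 : (n : ℕ) → 1 ≤ n → (j : ℕ) (S : Vec ℕ j) → Unique S → All (1 ≤_) S →
    (+ numFR-T2 n S) / 1 ≡ rhs n S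
theorem4p4 (suc n) _ j S S-unique 1≤S = begin
  + numFR-T2 (suc n) S / 1
    ≡⟨ /1≡ι (numFR-T2 (suc n) S) ⟩
  ι (numFR-T2 (suc n) S)
    ≡⟨ ι-numFR-T2≡∑validProfiles S n ⟩
  ∑validProfiles S (suc n) (suc n) 0 (suc n)
    ≡⟨ ∑validProfiles≡orderedPartitions S 1≤S S-unique (suc n) (suc n) 0 (suc n) ℕ.≤-refl ℕ.≤-refl ⟩
  orderedPartitions S (suc n)
    ≡⟨ rhs≡orderedPartitions S 1≤S (suc n) ⟨
  rhs (suc n) S ∎
  where open ≡-Reasoning
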